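{- Let $d\ge 6$, let $\Gamma\in\mathcal{F}(d)$ have order $2n$, let $G\le \mathrm{Aut}(\Gamma)$ act transitively on $E(\Gamma)$, and let $C\le G$ be a cyclic subgroup acting semiregularly on $V(\Gamma)$ with exactly two orbits such that the subgraph induced by one of these orbits is a cycle. Let $B$ be a non-trivial block for $G$ with $\mathcal{B}$ the block system it induces, and suppose $B$ is cyclic and $|B|<n/2$. Then the kernel of the action of $G$ on $\mathcal{B}$ equals $C_{\{B\}}$. Furthermore, $\Gamma$ is a normal cover of $\Gamma/\mathcal{B}$ and $\Gamma/\mathcal{B}\in\mathcal{F}(d)$.
   Context: All graphs are finite and simple. For $d\ge 3$, $\mathcal{F}(d)$ is the family of $d$-regular graphs admitting an automorphism with exactly two orbits of equal length such that the subgraph induced by one of them is a cycle. A block for $G$ is a subset $B\subseteq V(\Gamma)$ with $B^g=B$ or $B^g\cap B=\emptyset$ for all $g\in G$; it is non-trivial if $1<|B|<|V(\Gamma)|$, and the induced block system is $\{B^g:g\in G\}$. $B$ is called cyclic if it is contained in one of the two $C$-orbits. $C_{\{B\}}$ denotes the set-wise stabiliser of $B$ in $C$. The quotient graph $\Gamma/\mathcal{B}$ has vertex set $\mathcal{B}$, with $\{B_1,B_2\}$ an edge whenever $B_1\neq B_2$ and some edge of $\Gamma$ joins a vertex of $B_1$ to a vertex of $B_2$. $\Gamma$ is a cover of $\Gamma/\mathcal{B}$ if for every edge $\{u,v\}$ of $\Gamma$ the vertices $u,v$ lie in distinct blocks and $u$ has exactly one neighbour in the block containing $v$; it is a normal cover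 if moreover $\mathcal{B}$ is the set of orbits of a normal subgroup of $G$. -}

module Defs where

open import Data.Nat using (ℕ; zero; suc; _+_; _*_; _≤_; _<_)
open import Data.Bool using (Bool; true; false)
open import Data.Fin using (Fin; toℕ)
open import Data.Fin.Permutation using (Permutation′; _⟨$⟩ʳ_; _⟨$⟩ˡ_; id; flip; _∘ₚ_; _≈_)
open import Data.Fin.Subset using (Subset; _∈_; _∉_; ∣_∣)
open import Data.Vec using (tabulate)
open import Data.Product using (Σ; ∃; ∃-syntax; _×_; _,_)
open import Data.Sum using (_⊎_)
open import Function.Definitions using (Injective)
open import Function.Bundles using (_⇔_)
open import Relation.Binary.PropositionalEquality using (_≡_; _≢_)
open import Relation.Nullary using (¬_)

record Graph (N : ℕ) : Set where
  field
    adj   : Fin N → Fin N → Bool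
    sym   : ∀ u v → adj u v ≡ adj v u
    irref : ∀ v → adj v v ≡ false

open Graph public

Adj : ∀ {N} → Graph N → Fin N → Fin N → Set
Adj Γ u v = adj Γ u v ≡ true

degree : ∀ {N} → Graph N → Fin N → ℕ
degree Γ v = ∣ tabulate (λ w → adj Γ v w) ∣

Regular : ∀ {N} → ℕ → Graph N → Set
Regular d Γ = ∀ v → degree Γ v ≡ d

HasSize : ∀ {N} → ℕ → (Fin N → Set) → Set
HasSize {N} m S = Σ (Fin m → Fin N) λ f → Injective _≡_ _≡_ f × (∀ v → S v ⇔ (∃[ i ] f i ≡ v))

-- b ≡ a + 1 (mod m), for a, b < m
CycSucc : ℕ → ℕ → ℕ → Set
CycSucc m a b = (b ≡ suc a) ⊎ ((suc a ≡ m) × (b ≡ 0))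

InducesCycle : ∀ {N} → Graph N → (Fin N → Set) → Set
InducesCycle {N} Γ S =
  Σ ℕ λ m → 3 ≤ m × Σ (Fin m → Fin N) λ f →
    Injective _≡_ _≡_ f × (∀ v → S v ⇔ (∃[ i ] f i ≡ v)) ×
    (∀ i j → Adj Γ (f i) (f j) ⇔ (CycSucc m (toℕ i) (toℕ j) ⊎ CycSucc m (toℕ j) (toℕ i)))

IsAut : ∀ {N} → Graph N → Permutation′ N → Set
IsAut Γ σ = ∀ u v → adj Γ (σ ⟨$⟩ʳ u) (σ ⟨$⟩ʳ v) ≡ adj Γ u v

record IsPermGroup {N : ℕ} (P : Permutation′ N → Set) : Set where
  field
    resp   : ∀ σ τ → σ ≈ τ → P σ → P τ
    has-id : P id
    comp   : ∀ σ τ → P σ → P τ → P (σ ∘ₚ τ)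
    inv    : ∀ σ → P σ → P (flip σ)

IsAutGroup : ∀ {N} → Graph N → (Permutation′ N → Set) → Set
IsAutGroup Γ G = IsPermGroup G × (∀ σ → G σ → IsAut Γ σ)

pow : ∀ {N} → Permutation′ N → ℕ → Permutation′ N
pow c zero    = id
pow c (suc k) = c ∘ₚ pow c k

-- σ ∈ ⟨c⟩  (the group is finite, so nonnegative powers suffice)
InCyc : ∀ {N} → Permutation′ N → Permutation′ N → Set
InCyc c σ = ∃[ k ] σ ≈ pow c k

InOrbit : ∀ {N} → Permutation′ N → Fin N → Fin N → Set
InOrbit c u v = ∃[ k ] pow c k ⟨$⟩ʳ u ≡ v

TwoOrbits : ∀ {N} → Permutation′ N → Fin N → Fin N → Set
TwoOrbits c u w = ¬ InOrbit c u w × (∀ v → InOrbit c u v ⊎ InOrbit c w v)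

Semiregular : ∀ {N} → Permutation′ N → Set
Semiregular c = ∀ k v → pow c k ⟨$⟩ʳ v ≡ v → pow c k ≈ id

InF : ∀ {N} → ℕ → Graph N → Set
InF {N} d Γ =
  Regular d Γ ×
  Σ (Permutation′ N) λ ρ → IsAut Γ ρ × Σ (Fin N) λ u → Σ (Fin N) λ w →
    TwoOrbits ρ u w ×
    (Σ ℕ λ m → HasSize m (InOrbit ρ u) × HasSize m (InOrbit ρ w)) ×
    (InducesCycle Γ (InOrbit ρ u) ⊎ InducesCycle Γ (InOrbit ρ w))

EdgeTransitive : ∀ {N} → Graph N → (Permutation′ N → Set) → Set
EdgeTransitive Γ G = ∀ u v x y → Adj Γ u v → Adj Γ x y →
  Σ _ λ g → G g × (((g ⟨$⟩ʳ u ≡ x) × (g ⟨$⟩ʳ v ≡ y)) ⊎ ((g ⟨$⟩ʳ u ≡ y) × (g ⟨$⟩ʳ v ≡ x)))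

InImg : ∀ {N} → Permutation′ N → Subset N → Fin N → Set
InImg h B x = (h ⟨$⟩ˡ x) ∈ B

IsBlock : ∀ {N} → (Permutation′ N → Set) → Subset N → Set
IsBlock G B = ∀ g → G g →
  (∀ x → x ∈ B ⇔ (g ⟨$⟩ʳ x) ∈ B) ⊎ (∀ x → x ∈ B → (g ⟨$⟩ʳ x) ∉ B)

NonTrivial : ∀ {N} → Subset N → Set
NonTrivial {N} B = 1 < ∣ B ∣ × ∣ B ∣ < N

-- x and y lie in a common block B^h (h ∈ G) of the system 𝓑 = {B^h}
SameBlock : ∀ {N} → (Permutation′ N → Set) → Subset N → Fin N → Fin N → Set
SameBlock G B x y = Σ _ λ h → G h × InImg h B x × InImg h B y

InKernel : ∀ {N} → (Permutation′ N → Set) → Subset N → Permutation′ N → Set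
InKernel G B g = G g × (∀ h → G h → ∀ x → InImg h B x ⇔ InImg h B (g ⟨$⟩ʳ x))

InSetwiseStab : ∀ {N} → Permutation′ N → Subset N → Permutation′ N → Set
InSetwiseStab c B g = InCyc c g × (∀ x → x ∈ B ⇔ (g ⟨$⟩ʳ x) ∈ B)

-- Δ (on Fin M) together with π is (a labelled copy of) the quotient Γ/𝓑:
-- π is onto, its fibres are exactly the blocks of 𝓑, and i ~ j in Δ iff
-- i ≢ j and some edge of Γ joins the corresponding blocks.
IsQuotient : ∀ {N M} → Graph N → (Permutation′ N → Set) → Subset N →
             Graph M → (Fin N → Fin M) → Set
IsQuotient Γ G B Δ π =
  (∀ i → ∃[ x ] π x ≡ i) ×
  (∀ x y → (π x ≡ π y) ⇔ SameBlock G B x y) ×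
  (∀ i j → Adj Δ i j ⇔ (i ≢ j × Σ _ λ x → Σ _ λ y → π x ≡ i × π y ≡ j × Adj Γ x y))

IsCover : ∀ {N} → Graph N → (Permutation′ N → Set) → Subset N → Set
IsCover Γ G B = ∀ u v → Adj Γ u v →
  ¬ SameBlock G B u v × (∀ w → Adj Γ u w → SameBlock G B w v → w ≡ v)

IsNormalCover : ∀ {N} → Graph N → (Permutation′ N → Set) → Subset N → Set₁
IsNormalCover Γ G B =
  IsCover Γ G B ×
  Σ (Permutation′ _ → Set) λ K →
    IsPermGroup K × (∀ k → K k → G k) ×
    (∀ g k → G g → K k → K (flip g ∘ₚ (k ∘ₚ g))) ×
    (∀ x y → SameBlock G B x y ⇔ (Σ _ λ k → K k × k ⟨$⟩ʳ x ≡ y))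

{-# OPTIONS --safe #-}

-- Let U and W be the two ⟨c⟩-orbits, U inducing a cycle. The two U-neighbours of u are c^s u and
-- c^-s u for some s, and a = c^s is a semiregular generator of ⟨c⟩ stepping along that cycle.
-- Edge-transitivity makes G vertex-transitive, and a block, lying in one ⟨a⟩-orbit, has the form
-- {a^(tQ) y} with Q = n / |B| ≥ 3 because 2|B| < n. So the two cycle-neighbours a^±1 y of y lie
-- in blocks other than y's, which by edge-transitivity means Γ covers Γ/𝓑. A kernel element
-- fixing a vertex then fixes its neighbours, hence all of Γ (connected through the cycle and the
-- U–W edges that exist because d > 2); so the kernel is ⟨a^Q⟩ = C_{B}, a normal subgroup whose
-- orbits are the blocks. The quotient on the 2Q blocks is d-regular since Γ is a cover, and a
-- induces on it an automorphism with two orbits of length Q, one spanning the Q-cycle image of U.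
module Submission where

open import Defs hiding (sym)
open import Data.Nat hiding (_^_; NonTrivial)
open import Data.Nat.Properties
open import Data.Nat.DivMod
open import Data.Nat.Divisibility using (_∣_; divides; ∣⇒≤; %-presˡ-∣; m%n≡0⇒n∣m)
open import Data.Bool using (Bool; true; false)
open import Data.Bool.Properties using () renaming (_≟_ to _≟ᵇ_)
open import Data.Fin using (Fin; zero; suc; toℕ; fromℕ<; splitAt; join)
import Data.Fin.Properties as Finₚ
open import Data.Fin.Permutation as Perm
  using (Permutation′; _⟨$⟩ʳ_; _⟨$⟩ˡ_; _∘ₚ_; inverseˡ; inverseʳ)
open import Data.Fin.Subset using (Subset; ∣_∣; _∈_; Nonempty)
open import Data.Fin.Subset.Properties using (_∈?_)
open import Data.Vec using ([]; _∷_; here; there; lookup; tabulate)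
import Data.Vec.Properties as Vecₚ
open import Data.Product
open import Data.Sum using (_⊎_; inj₁; inj₂; [_,_]′)
import Data.Sum as Sum
open import Data.Sum.Properties using (inj₁-injective; inj₂-injective)
open import Data.Empty
open import Function.Bundles using (_⇔_; mk⇔; Equivalence)
open import Function.Definitions using (Injective)
open import Relation.Binary.PropositionalEquality
open import Relation.Nullary
open import Relation.Nullary.Decidable using (_×-dec_; ¬?; dec-true; dec-false)
open import Relation.Binary.Definitions using (tri<; tri≈; tri>)

open Equivalence using (to; from)

private
  variable
    N m m′ : ℕ

m+m≡n+n⇒m≡n : ∀ {m n} → m + m ≡ n + n → m ≡ n
m+m≡n+n⇒m≡n {m} {n} eq =
  *-cancelˡ-≡ m n 2 (trans (cong (m +_) (+-identityʳ m)) (trans eq (cong (n +_) (sym (+-identityʳ n)))))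

n∣m+m⇒m+m≡n : ∀ {m n} → 0 < m → m < n → n ∣ m + m → m + m ≡ n
n∣m+m⇒m+m≡n {m} {n} 0<m m<n (divides zero          m+m≡0)  = ⊥-elim (<-irrefl (sym m+m≡0) (<-≤-trans 0<m (m≤m+n m m)))
n∣m+m⇒m+m≡n {m} {n} 0<m m<n (divides (suc zero)    m+m≡n)  = trans m+m≡n (+-identityʳ n)
n∣m+m⇒m+m≡n {m} {n} 0<m m<n (divides (suc (suc q)) m+m≡qn) =
  ⊥-elim (<-irrefl m+m≡qn (<-≤-trans (+-mono-< m<n m<n) (+-monoʳ-≤ n (m≤m+n n (q * n)))))

half-nonZero : ∀ {n} → Fin (2 * n) → NonZero n
half-nonZero {suc n} _ = _

module _ {P : ℕ → Set} (P? : ∀ k → Dec (P k)) where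

  private
    search : ∀ i j → (∀ l → l < i → ¬ P l) → P (i + j) → ∃[ k ] P k × (∀ l → l < k → ¬ P l)
    search i zero below p = i , subst P (+-identityʳ i) p , below
    search i (suc j) below p with P? i
    ... | yes pᵢ = i , pᵢ , below
    ... | no ¬pᵢ = search (suc i) j below′ (subst P (+-suc i j) p)
      where
      below′ : ∀ l → l < suc i → ¬ P l
      below′ l l<1+i with m≤n⇒m<n∨m≡n (s≤s⁻¹ l<1+i)
      ... | inj₁ l<i  = below l l<i
      ... | inj₂ refl = ¬pᵢ

  least-witness : ∀ k → P k → ∃[ k′ ] P k′ × (∀ l → l < k′ → ¬ P l)
  least-witness k = search 0 k (λ _ ())

module _ {A C : Set} where

  does-cong : A ⇔ C → (a? : Dec A) (c? : Dec C) → does a? ≡ does c?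
  does-cong A⇔C a? (yes c) = dec-true a? (from A⇔C c)
  does-cong A⇔C a? (no ¬c) = dec-false a? (λ a → ¬c (to A⇔C a))

does≡true⇒ : ∀ {A : Set} (a? : Dec A) → does a? ≡ true → A
does≡true⇒ (yes a) _ = a

enum : (p : Subset N) → Fin ∣ p ∣ → Fin N
enum (true  ∷ p) zero    = zero
enum (true  ∷ p) (suc i) = suc (enum p i)
enum (false ∷ p) i       = suc (enum p i)

enum-∈ : ∀ (p : Subset N) i → enum p i ∈ p
enum-∈ (true  ∷ p) zero    = here
enum-∈ (true  ∷ p) (suc i) = there (enum-∈ p i)
enum-∈ (false ∷ p) i       = there (enum-∈ p i)

enum-injective : ∀ (p : Subset N) → Injective _≡_ _≡_ (enum p)
enum-injective (true  ∷ p) {zero}  {zero}  _  = refl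
enum-injective (true  ∷ p) {suc i} {suc j} eq = cong suc (enum-injective p (Finₚ.suc-injective eq))
enum-injective (false ∷ p)                 eq = enum-injective p (Finₚ.suc-injective eq)

enum-surjective : ∀ (p : Subset N) {x} → x ∈ p → ∃[ i ] enum p i ≡ x
enum-surjective (true  ∷ p) here = zero , refl
enum-surjective (true  ∷ p) (there x∈p) = map suc (cong suc) (enum-surjective p x∈p)
enum-surjective (false ∷ p) (there x∈p) = map₂ (cong suc) (enum-surjective p x∈p)

image-⊆⇒≤ : ∀ (f : Fin m → Fin N) (g : Fin m′ → Fin N) → Injective _≡_ _≡_ f →
            (∀ i → ∃[ j ] g j ≡ f i) → m ≤ m′
image-⊆⇒≤ f g f-inj f⊆g = Finₚ.injective⇒≤ {f = λ i → proj₁ (f⊆g i)} λ {i} {j} eq →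
  f-inj (trans (sym (proj₂ (f⊆g i))) (trans (cong g eq) (proj₂ (f⊆g j))))

same-image⇒≡ : ∀ (f : Fin m → Fin N) (g : Fin m′ → Fin N) →
               Injective _≡_ _≡_ f → Injective _≡_ _≡_ g →
               (∀ i → ∃[ j ] g j ≡ f i) → (∀ j → ∃[ i ] f i ≡ g j) → m ≡ m′
same-image⇒≡ f g f-inj g-inj f⊆g g⊆f = ≤-antisym (image-⊆⇒≤ f g f-inj f⊆g) (image-⊆⇒≤ g f g-inj g⊆f)

∣p∣≡-enumeration : ∀ (p : Subset N) (f : Fin m → Fin N) → Injective _≡_ _≡_ f →
                   (∀ i → f i ∈ p) → (∀ x → x ∈ p → ∃[ i ] f i ≡ x) → ∣ p ∣ ≡ m
∣p∣≡-enumeration p f f-inj f⊆p p⊆f = same-image⇒≡ (enum p) f (enum-injective p) f-inj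
  (λ i → p⊆f (enum p i) (enum-∈ p i)) (λ i → enum-surjective p (f⊆p i))

⊆pair⇒∣p∣≤2 : ∀ (p : Subset N) (y₁ y₂ : Fin N) → (∀ x → x ∈ p → x ≡ y₁ ⊎ x ≡ y₂) → ∣ p ∣ ≤ 2
⊆pair⇒∣p∣≤2 p y₁ y₂ p⊆ = image-⊆⇒≤ (enum p) (lookup (y₁ ∷ y₂ ∷ [])) (enum-injective p) λ i →
  [ (λ eq → zero , sym eq) , (λ eq → suc zero , sym eq) ]′ (p⊆ (enum p i) (enum-∈ p i))

∣p∣>0⇒nonempty : ∀ (p : Subset N) → 0 < ∣ p ∣ → Nonempty p
∣p∣>0⇒nonempty p 0<∣p∣ = enum p (fromℕ< 0<∣p∣) , enum-∈ p (fromℕ< 0<∣p∣)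

∈-tabulate⇔ : ∀ (f : Fin N → Bool) x → x ∈ tabulate f ⇔ f x ≡ true
∈-tabulate⇔ f x = mk⇔ (λ x∈ → trans (sym (Vecₚ.lookup∘tabulate f x)) (Vecₚ.[]=⇒lookup x∈))
                      (λ fx → Vecₚ.lookup⇒[]= x (tabulate f) (trans (Vecₚ.lookup∘tabulate f x) fx))

module _ {ℓ} (P : Fin ℓ → Set)
         (step-up : ∀ i j → toℕ j ≡ suc (toℕ i) → P i → P j)
         (step-down : ∀ i j → toℕ j ≡ suc (toℕ i) → P j → P i)
         (i₀ : Fin ℓ) (P-i₀ : P i₀) where

  private
    walk-up : ∀ t i → toℕ i ≡ toℕ i₀ + t → P i
    walk-up zero    i i≡i₀     = subst P (Finₚ.toℕ-injective (sym (trans i≡i₀ (+-identityʳ _)))) P-i₀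
    walk-up (suc t) i i≡i₀+1+t = step-up i′ i (trans i≡ (cong suc (sym (Finₚ.toℕ-fromℕ< i′<ℓ))))
                                         (walk-up t i′ (Finₚ.toℕ-fromℕ< i′<ℓ))
      where
      i≡ : toℕ i ≡ suc (toℕ i₀ + t)
      i≡ = trans i≡i₀+1+t (+-suc (toℕ i₀) t)
      i′<ℓ : toℕ i₀ + t < ℓ
      i′<ℓ = <-trans (subst (toℕ i₀ + t <_) (sym i≡) ≤-refl) (Finₚ.toℕ<n i)
      i′ = fromℕ< i′<ℓ

    walk-down : ∀ t i → toℕ i + t ≡ toℕ i₀ → P i
    walk-down zero    i i≡i₀     = subst P (Finₚ.toℕ-injective (sym (trans (sym (+-identityʳ (toℕ i))) i≡i₀))) P-i₀
    walk-down (suc t) i i+1+t≡i₀ = step-down i i′ (Finₚ.toℕ-fromℕ< i′<ℓ)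
                                             (walk-down t i′ (trans (cong (_+ t) (Finₚ.toℕ-fromℕ< i′<ℓ)) i′+t≡i₀))
      where
      i′+t≡i₀ : suc (toℕ i) + t ≡ toℕ i₀
      i′+t≡i₀ = trans (sym (+-suc (toℕ i) t)) i+1+t≡i₀
      i′<ℓ : suc (toℕ i) < ℓ
      i′<ℓ = ≤-<-trans (subst (suc (toℕ i) ≤_) i′+t≡i₀ (m≤m+n (suc (toℕ i)) t)) (Finₚ.toℕ<n i₀)
      i′ = fromℕ< i′<ℓ

  Fin-path-induction : ∀ i → P i
  Fin-path-induction i with ≤-total (toℕ i₀) (toℕ i)
  ... | inj₁ i₀≤i = walk-up (toℕ i ∸ toℕ i₀) i (sym (m+[n∸m]≡n i₀≤i))
  ... | inj₂ i≤i₀ = walk-down (toℕ i₀ ∸ toℕ i) i (m+[n∸m]≡n i≤i₀)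

inj₁≢inj₂ : ∀ {A B : Set} {x : A} {y : B} → inj₁ x ≢ inj₂ y
inj₁≢inj₂ ()

splitAt-injective : ∀ m n → Injective _≡_ _≡_ (splitAt m {n})
splitAt-injective m n {i} {j} eq =
  trans (sym (Finₚ.join-splitAt m n i)) (trans (cong (join m n) eq) (Finₚ.join-splitAt m n j))

join-injective : ∀ m n → Injective _≡_ _≡_ (join m n)
join-injective m n {a} {b} eq =
  trans (sym (Finₚ.splitAt-join m n a)) (trans (cong (splitAt m) eq) (Finₚ.splitAt-join m n b))

CycAdj : ℕ → ℕ → ℕ → Set
CycAdj m i j = CycSucc m i j ⊎ CycSucc m j i

CycSucc-functional : ∀ {m i j j′} → CycSucc m i j → CycSucc m i j′ → j < m → j′ < m → j ≡ j′
CycSucc-functional (inj₁ j≡1+i)       (inj₁ j′≡1+i)       _   _    = trans j≡1+i (sym j′≡1+i)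
CycSucc-functional (inj₁ j≡1+i)       (inj₂ (1+i≡m , _))  j<m _    = ⊥-elim (<-irrefl (trans j≡1+i 1+i≡m) j<m)
CycSucc-functional (inj₂ (1+i≡m , _)) (inj₁ j′≡1+i)       _   j′<m = ⊥-elim (<-irrefl (trans j′≡1+i 1+i≡m) j′<m)
CycSucc-functional (inj₂ (_ , j≡0))   (inj₂ (_ , j′≡0))   _   _    = trans j≡0 (sym j′≡0)

CycSucc-injective : ∀ {m i i′ j} → CycSucc m i j → CycSucc m i′ j → i ≡ i′
CycSucc-injective (inj₁ j≡1+i)       (inj₁ j≡1+i′)       = suc-injective (trans (sym j≡1+i) j≡1+i′)
CycSucc-injective (inj₁ j≡1+i)       (inj₂ (_ , j≡0))    with () ← trans (sym j≡1+i) j≡0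
CycSucc-injective (inj₂ (_ , j≡0))   (inj₁ j≡1+i′)       with () ← trans (sym j≡1+i′) j≡0
CycSucc-injective (inj₂ (1+i≡m , _)) (inj₂ (1+i′≡m , _)) = suc-injective (trans 1+i≡m (sym 1+i′≡m))

CycAdj-three : ∀ {m i j₁ j₂ j₃} → CycAdj m i j₁ → CycAdj m i j₂ → CycAdj m i j₃ →
               j₁ < m → j₂ < m → j₃ < m → j₁ ≡ j₂ ⊎ j₁ ≡ j₃ ⊎ j₂ ≡ j₃
CycAdj-three (inj₁ s₁) (inj₁ s₂) _         l₁ l₂ l₃ = inj₁ (CycSucc-functional s₁ s₂ l₁ l₂)
CycAdj-three (inj₁ s₁) (inj₂ p₂) (inj₁ s₃) l₁ l₂ l₃ = inj₂ (inj₁ (CycSucc-functional s₁ s₃ l₁ l₃))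
CycAdj-three (inj₁ s₁) (inj₂ p₂) (inj₂ p₃) l₁ l₂ l₃ = inj₂ (inj₂ (CycSucc-injective p₂ p₃))
CycAdj-three (inj₂ p₁) (inj₂ p₂) _         l₁ l₂ l₃ = inj₁ (CycSucc-injective p₁ p₂)
CycAdj-three (inj₂ p₁) (inj₁ s₂) (inj₂ p₃) l₁ l₂ l₃ = inj₂ (inj₁ (CycSucc-injective p₁ p₃))
CycAdj-three (inj₂ p₁) (inj₁ s₂) (inj₁ s₃) l₁ l₂ l₃ = inj₂ (inj₂ (CycSucc-functional s₂ s₃ l₂ l₃))

cyclic-neighbours : ∀ {m} → 3 ≤ m → ∀ i → i < m →
  Σ ℕ λ j → Σ ℕ λ k → j < m × k < m × CycSucc m i j × CycSucc m k i × j ≢ k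
cyclic-neighbours {m@(suc m-1)} 3≤m zero _ =
  1 , m-1 , <-≤-trans (s≤s (s≤s z≤n)) 3≤m , ≤-refl , inj₁ refl , inj₂ (refl , refl) ,
  λ 1≡m-1 → <-irrefl (cong suc 1≡m-1) 3≤m
cyclic-neighbours {m} 3≤m (suc i) 1+i<m with suc (suc i) <? m
... | yes 2+i<m = suc (suc i) , i , 2+i<m , <-trans (n<1+n i) 1+i<m , inj₁ refl , inj₁ refl ,
                  λ 2+i≡i → <-irrefl (sym 2+i≡i) (<-trans (n<1+n i) (n<1+n (suc i)))
... | no 2+i≮m = 0 , i , <-≤-trans z<s 3≤m , <-trans (n<1+n i) 1+i<m , inj₂ (2+i≡m , refl) , inj₁ refl ,
                 λ { refl → <-irrefl 2+i≡m 3≤m }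
  where
  2+i≡m : suc (suc i) ≡ m
  2+i≡m = ≤-antisym 1+i<m (≮⇒≥ 2+i≮m)

module _ {m : ℕ} .{{_ : NonZero m}} where

  CycSucc⇒%≡suc : ∀ {r r′} → CycSucc m r r′ → r′ % m ≡ suc r % m
  CycSucc⇒%≡suc (inj₁ r′≡1+r) = cong (_% m) r′≡1+r
  CycSucc⇒%≡suc {r} {r′} (inj₂ (1+r≡m , r′≡0)) = begin
    r′ % m       ≡⟨ cong (_% m) r′≡0 ⟩
    0 % m        ≡⟨ m<n⇒m%n≡m (>-nonZero⁻¹ m) ⟩
    0            ≡⟨ n%n≡0 m ⟨
    m % m        ≡⟨ cong (_% m) 1+r≡m ⟨
    suc r % m    ∎
    where open ≡-Reasoning

  %≡suc⇒CycSucc : ∀ {r r′} → r < m → r′ < m → r′ % m ≡ suc r % m → CycSucc m r r′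
  %≡suc⇒CycSucc {r} {r′} r<m r′<m eq with suc r <? m
  ... | yes 1+r<m = inj₁ (trans r′≡1+r%m (m<n⇒m%n≡m 1+r<m))
    where r′≡1+r%m = trans (sym (m<n⇒m%n≡m r′<m)) eq
  ... | no 1+r≮m = inj₂ (1+r≡m , trans (trans (sym (m<n⇒m%n≡m r′<m)) eq) (trans (cong (_% m) 1+r≡m) (n%n≡0 m)))
    where 1+r≡m = ≤-antisym r<m (≮⇒≥ 1+r≮m)

infixr 5 _^_·_
_^_·_ : Permutation′ N → ℕ → Fin N → Fin N
p ^ k · x = pow p k ⟨$⟩ʳ x

module _ {N} (p : Permutation′ N) where

  ^-suc : ∀ j x → p ^ j · (p ⟨$⟩ʳ x) ≡ p ⟨$⟩ʳ (p ^ j · x)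
  ^-suc zero    x = refl
  ^-suc (suc j) x = ^-suc j (p ⟨$⟩ʳ x)

  ^-+ : ∀ i j x → p ^ (i + j) · x ≡ p ^ i · p ^ j · x
  ^-+ zero    j x = refl
  ^-+ (suc i) j x = trans (^-+ i j (p ⟨$⟩ʳ x)) (cong (p ^ i ·_) (^-suc j x))

  ^-comm : ∀ i j x → p ^ i · p ^ j · x ≡ p ^ j · p ^ i · x
  ^-comm i j x = trans (sym (^-+ i j x)) (trans (cong (λ t → p ^ t · x) (+-comm i j)) (^-+ j i x))

  ^-* : ∀ s k x → pow p s ^ k · x ≡ p ^ (k * s) · x
  ^-* s zero    x = refl
  ^-* s (suc k) x = begin
    pow p s ^ k · p ^ s · x   ≡⟨ ^-* s k (p ^ s · x) ⟩
    p ^ (k * s) · p ^ s · x   ≡⟨ ^-+ (k * s) s x ⟨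
    p ^ (k * s + s) · x       ≡⟨ cong (λ t → p ^ t · x) (+-comm (k * s) s) ⟩
    p ^ (s + k * s) · x       ∎
    where open ≡-Reasoning

  ^-injective : ∀ k {x y} → p ^ k · x ≡ p ^ k · y → x ≡ y
  ^-injective k {x} {y} eq =
    trans (sym (inverseˡ (pow p k))) (trans (cong (pow p k ⟨$⟩ˡ_) eq) (inverseˡ (pow p k)))

  pow-closed : ∀ {G : Permutation′ N → Set} → IsPermGroup G → G p → ∀ k → G (pow p k)
  pow-closed G-grp p∈G zero    = IsPermGroup.has-id G-grp
  pow-closed G-grp p∈G (suc k) = IsPermGroup.comp G-grp p (pow p k) p∈G (pow-closed G-grp p∈G k)

  module Periodic (e : ℕ) (p^e≡id : ∀ y → p ^ e · y ≡ y) where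

    ^-multiple : ∀ t y → p ^ (t * e) · y ≡ y
    ^-multiple zero    y = refl
    ^-multiple (suc t) y = trans (^-+ e (t * e) y) (trans (cong (p ^ e ·_) (^-multiple t y)) (p^e≡id y))

    ^-cancel : ∀ i j t → i + j ≡ t * e → ∀ y → p ^ i · p ^ j · y ≡ y
    ^-cancel i j t i+j≡te y = trans (sym (^-+ i j y)) (trans (cong (λ k → p ^ k · y) i+j≡te) (^-multiple t y))

    module _ .{{_ : NonZero e}} where

      ^-mod : ∀ k y → p ^ k · y ≡ p ^ (k % e) · y
      ^-mod k y = trans (cong (λ t → p ^ t · y) (trans (m≡m%n+[m/n]*n k e) (+-comm (k % e) _)))
                        (trans (^-+ ((k / e) * e) (k % e) y) (^-multiple (k / e) _))

      ^-inverseˡ : ∀ k y → p ^ ((e ∸ 1) * k) · p ^ k · y ≡ y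
      ^-inverseˡ k = ^-cancel ((e ∸ 1) * k) k k (begin
        (e ∸ 1) * k + k   ≡⟨ +-comm ((e ∸ 1) * k) k ⟩
        suc (e ∸ 1) * k   ≡⟨ cong (_* k) (suc-pred e) ⟩
        e * k             ≡⟨ *-comm e k ⟩
        k * e             ∎)
        where open ≡-Reasoning

      ^-inverseʳ : ∀ k y → p ^ k · p ^ ((e ∸ 1) * k) · y ≡ y
      ^-inverseʳ k y = trans (^-comm k ((e ∸ 1) * k) y) (^-inverseˡ k y)

InOrbit-trans : ∀ {p : Permutation′ N} {x y z} → InOrbit p x y → InOrbit p y z → InOrbit p x z
InOrbit-trans {p = p} {x} (i , pⁱx≡y) (j , pʲy≡z) = j + i , trans (^-+ p j i x) (trans (cong (p ^ j ·_) pⁱx≡y) pʲy≡z)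

pow-orbit⊆orbit : ∀ {p : Permutation′ N} s {x y} → InOrbit (pow p s) x y → InOrbit p x y
pow-orbit⊆orbit {p = p} s {x} (k , eq) = k * s , trans (sym (^-* p s k x)) eq

-- Semiregular permutations with two orbits

record AllCyclesOfLength {N} (p : Permutation′ N) (e : ℕ) : Set where
  field
    ^-period   : ∀ y → p ^ e · y ≡ y
    ^-distinct : ∀ y {i j} → i < e → j < e → p ^ i · y ≡ p ^ j · y → i ≡ j

module CycleLengths {N} {p : Permutation′ N} {e} (cycles : AllCyclesOfLength p e) .{{_ : NonZero e}} where

  open AllCyclesOfLength cycles public
  open Periodic p e ^-period public

  ^-≡⇒%-≡ : ∀ y i j → p ^ i · y ≡ p ^ j · y → i % e ≡ j % e
  ^-≡⇒%-≡ y i j eq = ^-distinct y (m%n<n i e) (m%n<n j e) (trans (sym (^-mod i y)) (trans eq (^-mod j y)))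

  ^-fixes⇒∣ : ∀ y k → p ^ k · y ≡ y → e ∣ k
  ^-fixes⇒∣ y k pᵏy≡y = m%n≡0⇒n∣m k e (trans (^-≡⇒%-≡ y k 0 pᵏy≡y) (m<n⇒m%n≡m (>-nonZero⁻¹ e)))

  InOrbit-sym : ∀ {x y} → InOrbit p x y → InOrbit p y x
  InOrbit-sym {x} (k , pᵏx≡y) = (e ∸ 1) * k , trans (cong (p ^ ((e ∸ 1) * k) ·_) (sym pᵏx≡y)) (^-inverseˡ k x)

module _ {n : ℕ} {p : Permutation′ (2 * n)} {u w : Fin (2 * n)}
         (p-semireg : Semiregular p) (p-orbits : TwoOrbits p u w) where

  private
    equal-times⇒period : ∀ y {i j} → p ^ i · y ≡ p ^ j · y → i < j → ∀ z → p ^ (j ∸ i) · z ≡ z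
    equal-times⇒period y {i} {j} eq i<j = p-semireg (j ∸ i) (p ^ i · y)
      (trans (sym (^-+ p (j ∸ i) i y)) (trans (cong (λ t → p ^ t · y) (m∸n+n≡m (<⇒≤ i<j))) (sym eq)))

    Return : ℕ → Set
    Return k = 0 < k × p ^ k · u ≡ u

    returns : ∃ Return
    returns with Finₚ.pigeonhole (n<1+n (2 * n)) (λ (i : Fin (suc (2 * n))) → p ^ toℕ i · u)
    ... | i , j , i<j , eq = toℕ j ∸ toℕ i , m<n⇒0<n∸m i<j , equal-times⇒period u eq i<j u

    first-return = least-witness (λ k → (0 <? k) ×-dec (p ^ k · u Finₚ.≟ u)) (proj₁ returns) (proj₂ returns)

    e : ℕ
    e = proj₁ first-return

    instance
      e≢0 : NonZero e
      e≢0 = >-nonZero (proj₁ (proj₁ (proj₂ first-return)))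

    period : ∀ y → p ^ e · y ≡ y
    period = p-semireg e u (proj₂ (proj₁ (proj₂ first-return)))

    distinct< : ∀ y {i j} → i < j → j < e → p ^ i · y ≢ p ^ j · y
    distinct< y {i} {j} i<j j<e eq = proj₂ (proj₂ first-return) (j ∸ i) (≤-<-trans (m∸n≤m j i) j<e)
      (m<n⇒0<n∸m i<j , equal-times⇒period y eq i<j u)

    distinct : ∀ y {i j} → i < e → j < e → p ^ i · y ≡ p ^ j · y → i ≡ j
    distinct y {i} {j} i<e j<e eq with <-cmp i j
    ... | tri< i<j _ _ = ⊥-elim (distinct< y i<j j<e eq)
    ... | tri≈ _ i≡j _ = i≡j
    ... | tri> _ _ j<i = ⊥-elim (distinct< y j<i i<e (sym eq))

    open Periodic p e period

    orbits-disjoint : ∀ i j → p ^ i · u ≢ p ^ j · w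
    orbits-disjoint i j eq = proj₁ p-orbits ((e ∸ 1) * j + i ,
      trans (^-+ p ((e ∸ 1) * j) i u) (trans (cong (p ^ ((e ∸ 1) * j) ·_) eq) (^-inverseˡ j w)))

    on-orbits : Fin e ⊎ Fin e → Fin (2 * n)
    on-orbits = [ (λ r → p ^ toℕ r · u) , (λ r → p ^ toℕ r · w) ]′

    on-orbits-injective : Injective _≡_ _≡_ on-orbits
    on-orbits-injective {inj₁ r} {inj₁ r′} eq = cong inj₁ (Finₚ.toℕ-injective (distinct u (Finₚ.toℕ<n r) (Finₚ.toℕ<n r′) eq))
    on-orbits-injective {inj₁ r} {inj₂ r′} eq = ⊥-elim (orbits-disjoint (toℕ r) (toℕ r′) eq)
    on-orbits-injective {inj₂ r} {inj₁ r′} eq = ⊥-elim (orbits-disjoint (toℕ r′) (toℕ r) (sym eq))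
    on-orbits-injective {inj₂ r} {inj₂ r′} eq = cong inj₂ (Finₚ.toℕ-injective (distinct w (Finₚ.toℕ<n r) (Finₚ.toℕ<n r′) eq))

    orbit-position : ∀ {v} → InOrbit p u v ⊎ InOrbit p w v → Fin e ⊎ Fin e
    orbit-position (inj₁ (k , _)) = inj₁ (fromℕ< (m%n<n k e))
    orbit-position (inj₂ (k , _)) = inj₂ (fromℕ< (m%n<n k e))

    coordinates : Fin (2 * n) → Fin e ⊎ Fin e
    coordinates v = orbit-position (proj₂ p-orbits v)

    on-coordinates : ∀ v → on-orbits (coordinates v) ≡ v
    on-coordinates v with proj₂ p-orbits v
    ... | inj₁ (k , pᵏu≡v) = trans (cong (λ t → p ^ t · u) (Finₚ.toℕ-fromℕ< (m%n<n k e))) (trans (sym (^-mod k u)) pᵏu≡v)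
    ... | inj₂ (k , pᵏw≡v) = trans (cong (λ t → p ^ t · w) (Finₚ.toℕ-fromℕ< (m%n<n k e))) (trans (sym (^-mod k w)) pᵏw≡v)

    position : Fin (2 * n) → Fin (e + e)
    position v = join e e (coordinates v)

    position-injective : Injective _≡_ _≡_ position
    position-injective {x} {y} eq =
      trans (sym (on-coordinates x))
            (trans (cong on-orbits (join-injective e e {coordinates x} {coordinates y} eq)) (on-coordinates y))

    e+e≡2n : e + e ≡ 2 * n
    e+e≡2n = ≤-antisym
      (Finₚ.injective⇒≤ {f = λ i → on-orbits (splitAt e i)} λ eq → splitAt-injective e e (on-orbits-injective eq))
      (Finₚ.injective⇒≤ {f = position} position-injective)

    e≡n : e ≡ n
    e≡n = m+m≡n+n⇒m≡n (trans e+e≡2n (cong (n +_) (+-identityʳ n)))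

  semiregular-two-orbits⇒cycles : AllCyclesOfLength p n
  semiregular-two-orbits⇒cycles = subst (AllCyclesOfLength p) e≡n record
    { ^-period = period ; ^-distinct = distinct }

module Setting
  (d n : ℕ) (6≤d : 6 ≤ d) (Γ : Graph (2 * n)) (Γ∈F : InF d Γ)
  (G : Permutation′ (2 * n) → Set) (G≤AutΓ : IsAutGroup Γ G) (G-edge-transitive : EdgeTransitive Γ G)
  (c : Permutation′ (2 * n)) (c∈G : G c) (c-semiregular : Semiregular c)
  (u w : Fin (2 * n)) (c-orbits : TwoOrbits c u w) (U-cycle : InducesCycle Γ (InOrbit c u))
  (B : Subset (2 * n)) (B-block : IsBlock G B) (B-nontrivial : NonTrivial B)
  (B-cyclic : Σ (Fin (2 * n)) λ z → ∀ x → x ∈ B → InOrbit c z x)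
  (B-small : 2 * ∣ B ∣ < n)
  where

  Vertex : Set
  Vertex = Fin (2 * n)

  instance
    n≢0 : NonZero n
    n≢0 = half-nonZero u

  module C = CycleLengths (semiregular-two-orbits⇒cycles {n = n} c-semiregular c-orbits)

  neg : ℕ → ℕ
  neg k = (n ∸ 1) * k

  adj-sym : ∀ {x y} → Adj Γ x y → Adj Γ y x
  adj-sym {x} {y} x~y = trans (Graph.sym Γ y x) x~y

  adj-irrefl : ∀ {x} → ¬ Adj Γ x x
  adj-irrefl {x} x~x with () ← trans (sym x~x) (Graph.irref Γ x)

  G-group : IsPermGroup G
  G-group = proj₁ G≤AutΓ

  G-adj : ∀ {g} → G g → ∀ {x y} → Adj Γ x y → Adj Γ (g ⟨$⟩ʳ x) (g ⟨$⟩ʳ y)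
  G-adj {g} g∈G {x} {y} x~y = trans (proj₂ G≤AutΓ g g∈G x y) x~y

  G-comp : ∀ {g h} → G g → G h → G (g ∘ₚ h)
  G-comp {g} {h} = IsPermGroup.comp G-group g h

  G-inv : ∀ {g} → G g → G (Perm.flip g)
  G-inv {g} = IsPermGroup.inv G-group g

  c^-adj : ∀ k {x y} → Adj Γ x y → Adj Γ (c ^ k · x) (c ^ k · y)
  c^-adj k = G-adj (pow-closed c G-group c∈G k)

  -- The cycle on U and the generator a

  ℓ : ℕ
  ℓ = proj₁ U-cycle

  3≤ℓ : 3 ≤ ℓ
  3≤ℓ = proj₁ (proj₂ U-cycle)

  f : Fin ℓ → Vertex
  f = proj₁ (proj₂ (proj₂ U-cycle))

  f-injective : Injective _≡_ _≡_ f
  f-injective = proj₁ (proj₂ (proj₂ (proj₂ U-cycle)))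

  f-image : ∀ v → InOrbit c u v ⇔ (∃[ i ] f i ≡ v)
  f-image = proj₁ (proj₂ (proj₂ (proj₂ (proj₂ U-cycle))))

  f-adj : ∀ i j → Adj Γ (f i) (f j) ⇔ CycAdj ℓ (toℕ i) (toℕ j)
  f-adj = proj₂ (proj₂ (proj₂ (proj₂ (proj₂ U-cycle))))

  f-in-U : ∀ i → InOrbit c u (f i)
  f-in-U i = from (f-image (f i)) (i , refl)

  index : ∀ {v} → InOrbit c u v → Fin ℓ
  index {v} v∈U = proj₁ (to (f-image v) v∈U)

  f-index : ∀ {v} (v∈U : InOrbit c u v) → f (index v∈U) ≡ v
  f-index {v} v∈U = proj₂ (to (f-image v) v∈U)

  index-injective : ∀ {y y′} (y∈U : InOrbit c u y) (y′∈U : InOrbit c u y′) →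
                    toℕ (index y∈U) ≡ toℕ (index y′∈U) → y ≡ y′
  index-injective y∈U y′∈U eq = trans (sym (f-index y∈U)) (trans (cong f (Finₚ.toℕ-injective eq)) (f-index y′∈U))

  adj⇒CycAdj : ∀ {x y} (x∈U : InOrbit c u x) (y∈U : InOrbit c u y) → Adj Γ x y →
               CycAdj ℓ (toℕ (index x∈U)) (toℕ (index y∈U))
  adj⇒CycAdj x∈U y∈U x~y =
    to (f-adj (index x∈U) (index y∈U)) (subst₂ (Adj Γ) (sym (f-index x∈U)) (sym (f-index y∈U)) x~y)

  U-neighbour : Vertex → Vertex → Set
  U-neighbour x v = Adj Γ x v × InOrbit c u v

  U-neighbours-three : ∀ {x y₁ y₂ y₃} → InOrbit c u x →
    U-neighbour x y₁ → U-neighbour x y₂ → U-neighbour x y₃ → y₁ ≡ y₂ ⊎ y₁ ≡ y₃ ⊎ y₂ ≡ y₃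
  U-neighbours-three x∈U (x~y₁ , y₁∈U) (x~y₂ , y₂∈U) (x~y₃ , y₃∈U) =
    Sum.map (index-injective y₁∈U y₂∈U) (Sum.map (index-injective y₁∈U y₃∈U) (index-injective y₂∈U y₃∈U))
      (CycAdj-three (adj⇒CycAdj x∈U y₁∈U x~y₁) (adj⇒CycAdj x∈U y₂∈U x~y₂) (adj⇒CycAdj x∈U y₃∈U x~y₃)
                    (Finₚ.toℕ<n (index y₁∈U)) (Finₚ.toℕ<n (index y₂∈U)) (Finₚ.toℕ<n (index y₃∈U)))

  u∈U : InOrbit c u u
  u∈U = 0 , refl

  u-two-neighbours : Σ Vertex λ x₁ → Σ Vertex λ x₂ → U-neighbour u x₁ × U-neighbour u x₂ × x₁ ≢ x₂
  u-two-neighbours with cyclic-neighbours 3≤ℓ (toℕ i₀) (Finₚ.toℕ<n i₀)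
    where i₀ = index u∈U
  ... | j , k , j<ℓ , k<ℓ , i₀→j , k→i₀ , j≢k =
    f (fromℕ< j<ℓ) , f (fromℕ< k<ℓ) ,
    (u~f (fromℕ< j<ℓ) (inj₁ (subst (CycSucc ℓ _) (sym (Finₚ.toℕ-fromℕ< j<ℓ)) i₀→j)) , f-in-U _) ,
    (u~f (fromℕ< k<ℓ) (inj₂ (subst (λ t → CycSucc ℓ t _) (sym (Finₚ.toℕ-fromℕ< k<ℓ)) k→i₀)) , f-in-U _) ,
    λ eq → j≢k (trans (sym (Finₚ.toℕ-fromℕ< j<ℓ)) (trans (cong toℕ (f-injective eq)) (Finₚ.toℕ-fromℕ< k<ℓ)))
    where
    u~f : ∀ i → CycAdj ℓ (toℕ (index u∈U)) (toℕ i) → Adj Γ u (f i)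
    u~f i adj = subst (λ x → Adj Γ x (f i)) (f-index u∈U) (from (f-adj (index u∈U) i) adj)

  IsCycleStep : ℕ → Set
  IsCycleStep s = Adj Γ u (c ^ s · u) × (∀ v → U-neighbour u v → v ≡ c ^ s · u ⊎ v ≡ c ^ neg s · u)

  neg-neighbour : ∀ s → Adj Γ u (c ^ s · u) → U-neighbour u (c ^ neg s · u)
  neg-neighbour s u~cˢu =
    adj-sym (subst (Adj Γ (c ^ neg s · u)) (C.^-inverseˡ s u) (c^-adj (neg s) u~cˢu)) , (neg s , refl)

  double≡n : ∀ r → r < n → 0 < r → c ^ (r + r) · u ≡ u → r + r ≡ n
  double≡n r r<n 0<r c²ʳu≡u = n∣m+m⇒m+m≡n 0<r r<n (C.^-fixes⇒∣ u (r + r) c²ʳu≡u)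

  self-inverse-step⇒double≡n : ∀ s → s < n → Adj Γ u (c ^ s · u) → c ^ neg s · u ≡ c ^ s · u → s + s ≡ n
  self-inverse-step⇒double≡n zero    _   u~u _ = ⊥-elim (adj-irrefl u~u)
  self-inverse-step⇒double≡n (suc s) s<n _ c⁻ˢu≡cˢu = double≡n (suc s) s<n z<s (begin
    c ^ (suc s + suc s) · u          ≡⟨ ^-+ c (suc s) (suc s) u ⟩
    c ^ suc s · c ^ suc s · u        ≡⟨ cong (c ^ suc s ·_) c⁻ˢu≡cˢu ⟨
    c ^ suc s · c ^ neg (suc s) · u  ≡⟨ C.^-inverseʳ (suc s) u ⟩
    u                                ∎)
    where open ≡-Reasoning

  two-neighbours⇒step : ∀ {x y} s → U-neighbour u x → U-neighbour u y → x ≢ y →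
                        c ^ s · u ≡ x → c ^ neg s · u ≡ y → IsCycleStep s
  two-neighbours⇒step s (u~x , x∈U) u~y x≢y cˢu≡x c⁻ˢu≡y = subst (Adj Γ u) (sym cˢu≡x) u~x , λ v u~v →
    [ (λ v≡x → inj₁ (trans v≡x (sym cˢu≡x))) ,
      [ (λ v≡y → inj₂ (trans v≡y (sym c⁻ˢu≡y))) , (λ x≡y → ⊥-elim (x≢y x≡y)) ]′ ]′
    (U-neighbours-three u∈U u~v (u~x , x∈U) u~y)

  reduce : ∀ {x} → InOrbit c u x → ∃[ s ] s < n × c ^ s · u ≡ x
  reduce (k , cᵏu≡x) = k % n , m%n<n k n , trans (sym (C.^-mod k u)) cᵏu≡x

  -- Either c^-s₁ u = x₂ and s₁ is a step, or c^-s₁ u = x₁, forcing 2s₁ = n; then c^-s₂ u = x₂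
  -- is impossible (it would give 2s₂ = n, so s₁ = s₂), hence c^-s₂ u = x₁ and s₂ is a step.
  step-from-two : ∀ s₁ s₂ → s₁ < n → s₂ < n → Adj Γ u (c ^ s₁ · u) → Adj Γ u (c ^ s₂ · u) →
                  c ^ s₁ · u ≢ c ^ s₂ · u → ∃ IsCycleStep
  step-from-two s₁ s₂ s₁<n s₂<n u~x₁ u~x₂ x₁≢x₂ = first (U-neighbours-three u∈U (neg-neighbour s₁ u~x₁) nbr₁ nbr₂)
    where
    x₁ = c ^ s₁ · u
    x₂ = c ^ s₂ · u
    nbr₁ : U-neighbour u x₁
    nbr₁ = u~x₁ , s₁ , refl
    nbr₂ : U-neighbour u x₂
    nbr₂ = u~x₂ , s₂ , refl
    second : s₁ + s₁ ≡ n → c ^ neg s₂ · u ≡ x₁ ⊎ c ^ neg s₂ · u ≡ x₂ ⊎ x₁ ≡ x₂ → ∃ IsCycleStep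
    second _     (inj₁ c⁻ˢ²u≡x₁)        = s₂ , two-neighbours⇒step s₂ nbr₂ nbr₁ (λ eq → x₁≢x₂ (sym eq)) refl c⁻ˢ²u≡x₁
    second 2s₁≡n (inj₂ (inj₁ c⁻ˢ²u≡x₂)) = ⊥-elim (x₁≢x₂ (cong (λ t → c ^ t · u)
      (m+m≡n+n⇒m≡n {s₁} {s₂} (trans 2s₁≡n (sym (self-inverse-step⇒double≡n s₂ s₂<n u~x₂ c⁻ˢ²u≡x₂))))))
    second _     (inj₂ (inj₂ x₁≡x₂))    = ⊥-elim (x₁≢x₂ x₁≡x₂)
    first : c ^ neg s₁ · u ≡ x₁ ⊎ c ^ neg s₁ · u ≡ x₂ ⊎ x₁ ≡ x₂ → ∃ IsCycleStep
    first (inj₁ c⁻ˢ¹u≡x₁)        = second (self-inverse-step⇒double≡n s₁ s₁<n u~x₁ c⁻ˢ¹u≡x₁)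
      (U-neighbours-three u∈U (neg-neighbour s₂ u~x₂) nbr₁ nbr₂)
    first (inj₂ (inj₁ c⁻ˢ¹u≡x₂)) = s₁ , two-neighbours⇒step s₁ nbr₁ nbr₂ x₁≢x₂ refl c⁻ˢ¹u≡x₂
    first (inj₂ (inj₂ x₁≡x₂))    = ⊥-elim (x₁≢x₂ x₁≡x₂)

  distinct-U-neighbours⇒step : ∀ {x₁ x₂} → U-neighbour u x₁ → U-neighbour u x₂ → x₁ ≢ x₂ → ∃ IsCycleStep
  distinct-U-neighbours⇒step (u~x₁ , x₁∈U) (u~x₂ , x₂∈U) x₁≢x₂ =
    let s₁ , s₁<n , cˢ¹u≡x₁ = reduce x₁∈U
        s₂ , s₂<n , cˢ²u≡x₂ = reduce x₂∈U
    in step-from-two s₁ s₂ s₁<n s₂<n (subst (Adj Γ u) (sym cˢ¹u≡x₁) u~x₁) (subst (Adj Γ u) (sym cˢ²u≡x₂) u~x₂)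
                     (λ eq → x₁≢x₂ (trans (sym cˢ¹u≡x₁) (trans eq cˢ²u≡x₂)))

  opaque
    cycle-step : ∃ IsCycleStep
    cycle-step = let (_ , _ , nbr₁ , nbr₂ , x₁≢x₂) = u-two-neighbours in distinct-U-neighbours⇒step nbr₁ nbr₂ x₁≢x₂

  s : ℕ
  s = proj₁ cycle-step

  a : Permutation′ (2 * n)
  a = pow c s

  a∈G : G a
  a∈G = pow-closed c G-group c∈G s

  a^-closed : ∀ k → G (pow a k)
  a^-closed = pow-closed a G-group a∈G

  a^≡c^ : ∀ k x → a ^ k · x ≡ c ^ (k * s) · x
  a^≡c^ = ^-* c s

  a≡cˢ : ∀ x → a ^ 1 · x ≡ c ^ s · x
  a≡cˢ x = trans (a^≡c^ 1 x) (cong (λ t → c ^ t · x) (+-identityʳ s))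

  unshift : ∀ k {y z} → c ^ neg k · y ≡ z → y ≡ c ^ k · z
  unshift k {y} c⁻ᵏy≡z = trans (sym (C.^-inverseʳ k y)) (cong (c ^ k ·_) c⁻ᵏy≡z)

  U-neighbours : ∀ {x} → InOrbit c u x → ∀ {v} → U-neighbour x v → v ≡ c ^ s · x ⊎ v ≡ c ^ neg s · x
  U-neighbours {x} (k , cᵏu≡x) {v} (x~v , v∈U) =
    Sum.map (λ eq → trans (unshift k eq) (trans (^-comm c k s u) (cong (c ^ s ·_) cᵏu≡x)))
            (λ eq → trans (unshift k eq) (trans (^-comm c k (neg s) u) (cong (c ^ neg s ·_) cᵏu≡x)))
            (proj₂ (proj₂ cycle-step) (c ^ neg k · v) (u~c⁻ᵏv , InOrbit-trans v∈U (neg k , refl)))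
    where
    u~c⁻ᵏv : Adj Γ u (c ^ neg k · v)
    u~c⁻ᵏv = subst (λ y → Adj Γ y (c ^ neg k · v))
                   (trans (cong (c ^ neg k ·_) (sym cᵏu≡x)) (C.^-inverseˡ k u)) (c^-adj (neg k) x~v)

  U-step-adj : ∀ {x} → InOrbit c u x → Adj Γ x (c ^ s · x)
  U-step-adj (k , cᵏu≡x) =
    subst₂ (Adj Γ) cᵏu≡x (trans (^-comm c k s u) (cong (c ^ s ·_) cᵏu≡x)) (c^-adj k (proj₁ (proj₂ cycle-step)))

  Uₐ : Vertex → Set
  Uₐ = InOrbit a u

  Uₐ⊆U : ∀ {x} → Uₐ x → InOrbit c u x
  Uₐ⊆U = pow-orbit⊆orbit s

  Uₐ-closed : ∀ {x v} → Uₐ x → U-neighbour x v → Uₐ v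
  Uₐ-closed {x} (k , aᵏu≡x) x~v = [ step 1 (a≡cˢ x) , step (n ∸ 1) (a^≡c^ (n ∸ 1) x) ]′ (U-neighbours (Uₐ⊆U (k , aᵏu≡x)) x~v)
    where
    step : ∀ j {v} → a ^ j · x ≡ v → ∀ {v′} → v′ ≡ v → Uₐ v′
    step j aʲx≡v v′≡v = j + k , trans (^-+ a j k u) (trans (cong (a ^ j ·_) aᵏu≡x) (trans aʲx≡v (sym v′≡v)))

  consecutive-U-neighbours : ∀ i j → toℕ j ≡ suc (toℕ i) → U-neighbour (f i) (f j) × U-neighbour (f j) (f i)
  consecutive-U-neighbours i j j≡1+i =
    (from (f-adj i j) (inj₁ (inj₁ j≡1+i)) , f-in-U j) , (from (f-adj j i) (inj₂ (inj₁ j≡1+i)) , f-in-U i)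

  f-in-Uₐ : ∀ i → Uₐ (f i)
  f-in-Uₐ = Fin-path-induction (λ i → Uₐ (f i))
    (λ i j j≡1+i fi∈Uₐ → Uₐ-closed fi∈Uₐ (proj₁ (consecutive-U-neighbours i j j≡1+i)))
    (λ i j j≡1+i fj∈Uₐ → Uₐ-closed fj∈Uₐ (proj₂ (consecutive-U-neighbours i j j≡1+i)))
    (index u∈U) (subst Uₐ (sym (f-index u∈U)) (0 , refl))

  U⊆Uₐ : ∀ {x} → InOrbit c u x → Uₐ x
  U⊆Uₐ x∈U = subst Uₐ (f-index x∈U) (f-in-Uₐ (index x∈U))

  opaque
    c∈⟨a⟩ : ∃[ k₀ ] ∀ y → c ⟨$⟩ʳ y ≡ a ^ k₀ · y
    c∈⟨a⟩ = k₀ , λ y → trans (sym (unshift 1 (c⁻¹aᵏ⁰≡id y))) (sym (a^≡c^ k₀ y))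
      where
      cu∈Uₐ : Uₐ (c ⟨$⟩ʳ u)
      cu∈Uₐ = U⊆Uₐ (1 , refl)
      k₀ : ℕ
      k₀ = proj₁ cu∈Uₐ
      -- c^-1 a^k₀ fixes u, so it is the identity by semiregularity.
      c⁻¹aᵏ⁰≡id : ∀ y → c ^ neg 1 · c ^ (k₀ * s) · y ≡ y
      c⁻¹aᵏ⁰≡id y = trans (sym (^-+ c (neg 1) (k₀ * s) y)) (c-semiregular (neg 1 + k₀ * s) u
        (trans (^-+ c (neg 1) (k₀ * s) u)
          (trans (cong (c ^ neg 1 ·_) (trans (sym (a^≡c^ k₀ u)) (proj₂ cu∈Uₐ))) (C.^-inverseˡ 1 u)))
        y)

  c^≡a^ : ∀ k y → c ^ k · y ≡ a ^ (k * proj₁ c∈⟨a⟩) · y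
  c^≡a^ zero    y = refl
  c^≡a^ (suc k) y = begin
    c ^ k · (c ⟨$⟩ʳ y)                     ≡⟨ c^≡a^ k (c ⟨$⟩ʳ y) ⟩
    a ^ (k * k₀) · (c ⟨$⟩ʳ y)              ≡⟨ cong (a ^ (k * k₀) ·_) (proj₂ c∈⟨a⟩ y) ⟩
    a ^ (k * k₀) · a ^ k₀ · y              ≡⟨ ^-+ a (k * k₀) k₀ y ⟨
    a ^ (k * k₀ + k₀) · y                  ≡⟨ cong (λ t → a ^ t · y) (+-comm (k * k₀) k₀) ⟩
    a ^ (k₀ + k * k₀) · y                  ∎
    where
    open ≡-Reasoning
    k₀ = proj₁ c∈⟨a⟩

  c-orbit⊆a-orbit : ∀ {x y} → InOrbit c x y → InOrbit a x y
  c-orbit⊆a-orbit {x} (k , cᵏx≡y) = k * proj₁ c∈⟨a⟩ , trans (sym (c^≡a^ k x)) cᵏx≡y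

  a-semiregular : Semiregular a
  a-semiregular k v aᵏv≡v y = trans (a^≡c^ k y) (c-semiregular (k * s) v (trans (sym (a^≡c^ k v)) aᵏv≡v) y)

  a-orbits : TwoOrbits a u w
  a-orbits = (λ w∈Uₐ → proj₁ c-orbits (Uₐ⊆U w∈Uₐ)) , λ v → Sum.map c-orbit⊆a-orbit c-orbit⊆a-orbit (proj₂ c-orbits v)

  module A = CycleLengths (semiregular-two-orbits⇒cycles {n = n} a-semiregular a-orbits)

  Uₐ-neighbours : ∀ {x v} → Uₐ x → Adj Γ x v → Uₐ v → v ≡ a ^ 1 · x ⊎ v ≡ a ^ (n ∸ 1) · x
  Uₐ-neighbours {x} x∈Uₐ x~v v∈Uₐ =
    Sum.map (λ eq → trans eq (sym (a≡cˢ x))) (λ eq → trans eq (sym (a^≡c^ (n ∸ 1) x)))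
            (U-neighbours (Uₐ⊆U x∈Uₐ) (x~v , Uₐ⊆U v∈Uₐ))

  Uₐ-adj : ∀ {x} → Uₐ x → Adj Γ x (a ^ 1 · x)
  Uₐ-adj {x} x∈Uₐ = subst (Adj Γ x) (sym (a≡cˢ x)) (U-step-adj (Uₐ⊆U x∈Uₐ))

  -- Blocks

  b : ℕ
  b = ∣ B ∣

  instance
    b≢0 : NonZero b
    b≢0 = >-nonZero (<-trans z<s (proj₁ B-nontrivial))

  block-preserved : ∀ {g} → G g → ∀ {x} → x ∈ B → g ⟨$⟩ʳ x ∈ B → ∀ y → y ∈ B ⇔ g ⟨$⟩ʳ y ∈ B
  block-preserved {g} g∈G {x} x∈B gx∈B =
    [ (λ preserved → preserved) , (λ moved → ⊥-elim (moved x x∈B gx∈B)) ]′ (B-block g g∈G)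

  images-meet⇒equal : ∀ {h k} → G h → G k → ∀ {x} → InImg h B x → InImg k B x →
                      ∀ y → InImg h B y ⇔ InImg k B y
  images-meet⇒equal {h} {k} h∈G k∈G {x} x∈Bʰ x∈Bᵏ y = mk⇔
    (λ y∈Bʰ → subst (_∈ B) k⁻¹hh⁻¹≡k⁻¹ (to (preserved (h ⟨$⟩ˡ y)) y∈Bʰ))
    (λ y∈Bᵏ → from (preserved (h ⟨$⟩ˡ y)) (subst (_∈ B) (sym k⁻¹hh⁻¹≡k⁻¹) y∈Bᵏ))
    where
    k⁻¹hh⁻¹≡k⁻¹ : ∀ {z} → k ⟨$⟩ˡ (h ⟨$⟩ʳ (h ⟨$⟩ˡ z)) ≡ k ⟨$⟩ˡ z
    k⁻¹hh⁻¹≡k⁻¹ = cong (k ⟨$⟩ˡ_) (inverseʳ h)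
    preserved = block-preserved (G-comp h∈G (G-inv k∈G)) x∈Bʰ (subst (_∈ B) (sym k⁻¹hh⁻¹≡k⁻¹) x∈Bᵏ)

  image-preserved : ∀ {g h} → G g → G h → ∀ {x} → InImg h B x → InImg h B (g ⟨$⟩ʳ x) →
                    ∀ z → InImg h B z ⇔ InImg h B (g ⟨$⟩ʳ z)
  image-preserved {g} {h} g∈G h∈G = images-meet⇒equal h∈G (G-comp h∈G (G-inv g∈G))

  has-neighbour : ∀ x → ∃[ y ] Adj Γ x y
  has-neighbour x = let y , y∈N = ∣p∣>0⇒nonempty (tabulate (adj Γ x)) 0<deg in y , to (∈-tabulate⇔ (adj Γ x) y) y∈N
    where
    0<deg : 0 < degree Γ x
    0<deg = subst (0 <_) (sym (proj₁ Γ∈F x)) (<-≤-trans z<s 6≤d)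

  from-u : ∀ x → ∃[ g ] G g × g ⟨$⟩ʳ u ≡ x
  from-u x with G-edge-transitive u (a ^ 1 · u) x (proj₁ (has-neighbour x)) (Uₐ-adj (0 , refl)) (proj₂ (has-neighbour x))
  ... | g , g∈G , inj₁ (gu≡x , _) = g , g∈G , gu≡x
  ... | g , g∈G , inj₂ (_ , gau≡x) = pow a 1 ∘ₚ g , G-comp (a^-closed 1) g∈G , gau≡x

  vertex-transitive : ∀ x y → ∃[ g ] G g × g ⟨$⟩ʳ x ≡ y
  vertex-transitive x y =
    let g , g∈G , gu≡x = from-u x
        h , h∈G , hu≡y = from-u y
    in Perm.flip g ∘ₚ h , G-comp (G-inv g∈G) h∈G ,
       trans (cong (h ⟨$⟩ʳ_) (trans (cong (g ⟨$⟩ˡ_) (sym gu≡x)) (inverseˡ g))) hu≡y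

  B-point : Σ Vertex (_∈ B)
  B-point = ∣p∣>0⇒nonempty B (<-trans z<s (proj₁ B-nontrivial))

  in-some-block : ∀ x → ∃[ h ] G h × InImg h B x
  in-some-block x = let g , g∈G , gz≡x = vertex-transitive (proj₁ B-point) x in
    g , g∈G , subst (_∈ B) (sym (trans (cong (g ⟨$⟩ˡ_) (sym gz≡x)) (inverseˡ g))) (proj₂ B-point)

  SB : Vertex → Vertex → Set
  SB = SameBlock G B

  SB-sym : ∀ {x y} → SB x y → SB y x
  SB-sym (h , h∈G , x∈Bʰ , y∈Bʰ) = h , h∈G , y∈Bʰ , x∈Bʰ

  SB-in-image : ∀ {x y} → SB x y → ∀ {k} → G k → InImg k B x → InImg k B y
  SB-in-image {y = y} (h , h∈G , x∈Bʰ , y∈Bʰ) k∈G x∈Bᵏ = to (images-meet⇒equal h∈G k∈G x∈Bʰ x∈Bᵏ y) y∈Bʰ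

  SB-trans : ∀ {x y z} → SB x y → SB y z → SB x z
  SB-trans (h , h∈G , x∈Bʰ , y∈Bʰ) y~z = h , h∈G , x∈Bʰ , SB-in-image y~z h∈G y∈Bʰ

  SB-G : ∀ {g} → G g → ∀ {x y} → SB x y → SB (g ⟨$⟩ʳ x) (g ⟨$⟩ʳ y)
  SB-G {g} g∈G (h , h∈G , x∈Bʰ , y∈Bʰ) =
    h ∘ₚ g , G-comp h∈G g∈G , subst (_∈ B) g⁻¹g≡id x∈Bʰ , subst (_∈ B) g⁻¹g≡id y∈Bʰ
    where
    g⁻¹g≡id : ∀ {z} → h ⟨$⟩ˡ z ≡ h ⟨$⟩ˡ (g ⟨$⟩ˡ (g ⟨$⟩ʳ z))
    g⁻¹g≡id = cong (h ⟨$⟩ˡ_) (sym (inverseˡ g))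

  B-in-a-orbit : ∀ {x} → x ∈ B → InOrbit a (proj₁ B-cyclic) x
  B-in-a-orbit x∈B = c-orbit⊆a-orbit (proj₂ B-cyclic _ x∈B)

  image-in-a-orbit : ∀ {h} → G h → ∀ {p} → InImg h B p → InOrbit a (proj₁ B-cyclic) p →
                     ∀ {y} → InImg h B y → InOrbit a (proj₁ B-cyclic) y
  -- B^h meets B^(a^j) at p = a^j z₀ (z₀ ∈ B), so B^h = a^j B lies in the a-orbit of B.
  image-in-a-orbit {h} h∈G {p} p∈Bʰ p∈Z {y} y∈Bʰ =
    InOrbit-trans (B-in-a-orbit (to (images-meet⇒equal h∈G (a^-closed j) p∈Bʰ p∈Bᵃʲ y) y∈Bʰ)) (j , inverseʳ (pow a j))
    where
    z₀→p = InOrbit-trans (A.InOrbit-sym (B-in-a-orbit (proj₂ B-point))) p∈Z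
    j = proj₁ z₀→p
    p∈Bᵃʲ : InImg (pow a j) B p
    p∈Bᵃʲ = subst (_∈ B) (sym (trans (cong (pow a j ⟨$⟩ˡ_) (sym (proj₂ z₀→p))) (inverseˡ (pow a j)))) (proj₂ B-point)

  block-in-a-orbit : ∀ {h} → G h → ∀ {x v} → InImg h B x → InImg h B v → InOrbit a x v
  block-in-a-orbit {h} h∈G {x} {v} x∈Bʰ v∈Bʰ = cases (proj₂ a-orbits x) (proj₂ a-orbits v) (proj₂ a-orbits z)
    where
    z = proj₁ B-cyclic
    same : ∀ {o p q} → InOrbit a o p → InOrbit a o q → InOrbit a p q
    same o→p o→q = InOrbit-trans (A.InOrbit-sym o→p) o→q
    via-x : InOrbit a z x → InOrbit a x v
    via-x z→x = same z→x (image-in-a-orbit h∈G x∈Bʰ z→x v∈Bʰ)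
    via-v : InOrbit a z v → InOrbit a x v
    via-v z→v = same (image-in-a-orbit h∈G v∈Bʰ z→v x∈Bʰ) z→v
    cases : InOrbit a u x ⊎ InOrbit a w x → InOrbit a u v ⊎ InOrbit a w v → InOrbit a u z ⊎ InOrbit a w z → InOrbit a x v
    cases (inj₁ u→x) (inj₁ u→v) _          = same u→x u→v
    cases (inj₂ w→x) (inj₂ w→v) _          = same w→x w→v
    cases (inj₁ u→x) (inj₂ w→v) (inj₁ u→z) = via-x (same u→z u→x)
    cases (inj₁ u→x) (inj₂ w→v) (inj₂ w→z) = via-v (same w→z w→v)
    cases (inj₂ w→x) (inj₁ u→v) (inj₁ u→z) = via-v (same u→z u→v)
    cases (inj₂ w→x) (inj₁ u→v) (inj₂ w→z) = via-x (same w→z w→x)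

  -- The image B^h through y is {a^(tq) y | t < n / q} for the least q > 0 with a^q y ∈ B^h.
  module BlockThrough {h} (h∈G : G h) {y} (y∈Bʰ : InImg h B y) where

    Hits : ℕ → Set
    Hits j = InImg h B (a ^ j · y)

    hits-preserve : ∀ i → Hits i → ∀ z → InImg h B z ⇔ InImg h B (a ^ i · z)
    hits-preserve i hits-i = image-preserved (a^-closed i) h∈G y∈Bʰ hits-i

    hits-+ : ∀ i j → Hits i → Hits j → Hits (i + j)
    hits-+ i j hits-i hits-j = subst (InImg h B) (sym (^-+ a i j y)) (to (hits-preserve i hits-i _) hits-j)

    hits-∸ : ∀ i j → i ≤ j → Hits i → Hits j → Hits (j ∸ i)
    hits-∸ i j i≤j hits-i hits-j = from (hits-preserve i hits-i _)
      (subst (InImg h B) (trans (cong (λ t → a ^ t · y) (sym (m+[n∸m]≡n i≤j))) (^-+ a i (j ∸ i) y)) hits-j)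

    opaque
      first-hit : ∃[ q ] (0 < q × Hits q) × (∀ j → j < q → ¬ (0 < j × Hits j))
      first-hit = least-witness (λ k → (0 <? k) ×-dec ((h ⟨$⟩ˡ (a ^ k · y)) ∈? B)) n
        (>-nonZero⁻¹ n , subst (InImg h B) (sym (A.^-period y)) y∈Bʰ)

    q : ℕ
    q = proj₁ first-hit

    instance
      q≢0 : NonZero q
      q≢0 = >-nonZero (proj₁ (proj₁ (proj₂ first-hit)))

    hits-*q : ∀ t → Hits (t * q)
    hits-*q zero    = y∈Bʰ
    hits-*q (suc t) = hits-+ q (t * q) (proj₂ (proj₁ (proj₂ first-hit))) (hits-*q t)

    hits⇒q∣ : ∀ j → Hits j → q ∣ j
    hits⇒q∣ j hits-j = m%n≡0⇒n∣m j q (remainder-zero (j % q) (m%n<n j q) hits-rem)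
      where
      hits-rem : Hits (j % q)
      hits-rem = subst Hits (sym (m%n≡m∸m/n*n j q)) (hits-∸ ((j / q) * q) j (m/n*n≤m j q) (hits-*q (j / q)) hits-j)
      remainder-zero : ∀ r → r < q → Hits r → r ≡ 0
      remainder-zero zero    _   _      = refl
      remainder-zero (suc r) r<q hits-r = ⊥-elim (proj₂ (proj₂ first-hit) (suc r) r<q (z<s , hits-r))

    hits⇔q∣ : ∀ j → Hits j ⇔ q ∣ j
    hits⇔q∣ j = mk⇔ (hits⇒q∣ j) λ { (divides t refl) → hits-*q t }

    q∣n : q ∣ n
    q∣n = hits⇒q∣ n (subst (InImg h B) (sym (A.^-period y)) y∈Bʰ)

    orbit-enum : Fin (n / q) → Vertex
    orbit-enum t = a ^ (toℕ t * q) · y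

    orbit-enum-injective : Injective _≡_ _≡_ orbit-enum
    orbit-enum-injective {t} {t′} eq = Finₚ.toℕ-injective (*-cancelʳ-≡ (toℕ t) (toℕ t′) q
      (A.^-distinct y (below (Finₚ.toℕ<n t)) (below (Finₚ.toℕ<n t′)) eq))
      where
      below : ∀ {r} → r < n / q → r * q < n
      below {r} r<n/q = subst (r * q <_) (m/n*n≡m q∣n) (*-monoˡ-< q r<n/q)

    block-enum : Fin b → Vertex
    block-enum i = h ⟨$⟩ʳ enum B i

    block-enum-injective : Injective _≡_ _≡_ block-enum
    block-enum-injective eq = enum-injective B (^-injective-h eq)
      where
      ^-injective-h : ∀ {x x′} → h ⟨$⟩ʳ x ≡ h ⟨$⟩ʳ x′ → x ≡ x′
      ^-injective-h {x} {x′} eq = trans (sym (inverseˡ h)) (trans (cong (h ⟨$⟩ˡ_) eq) (inverseˡ h))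

    block-enum-onto : ∀ x → InImg h B x → ∃[ i ] block-enum i ≡ x
    block-enum-onto x x∈Bʰ = let i , eq = enum-surjective B x∈Bʰ in i , trans (cong (h ⟨$⟩ʳ_) eq) (inverseʳ h)

    orbit-enum-onto : ∀ x → InImg h B x → ∃[ t ] orbit-enum t ≡ x
    orbit-enum-onto x x∈Bʰ =
      fromℕ< t<n/q ,
      trans (cong (λ r → a ^ (r * q) · y) (Finₚ.toℕ-fromℕ< t<n/q)) (trans (cong (λ r → a ^ r · y) (sym j≡tq)) aʲy≡x)
      where
      y→x = block-in-a-orbit h∈G y∈Bʰ x∈Bʰ
      j = proj₁ y→x % n
      aʲy≡x : a ^ j · y ≡ x
      aʲy≡x = trans (sym (A.^-mod (proj₁ y→x) y)) (proj₂ y→x)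
      q∣j = hits⇒q∣ j (subst (InImg h B) (sym aʲy≡x) x∈Bʰ)
      t = _∣_.quotient q∣j
      j≡tq : j ≡ t * q
      j≡tq = _∣_.equality q∣j
      t<n/q : t < n / q
      t<n/q = *-cancelʳ-< q t (n / q) (subst₂ _<_ j≡tq (sym (m/n*n≡m q∣n)) (m%n<n (proj₁ y→x) n))

    n≡bq : n ≡ b * q
    n≡bq = trans (sym (m/n*n≡m q∣n)) (cong (_* q) (same-image⇒≡ orbit-enum block-enum
      orbit-enum-injective block-enum-injective
      (λ t → block-enum-onto (orbit-enum t) (hits-*q (toℕ t)))
      (λ i → orbit-enum-onto (block-enum i) (subst (_∈ B) (sym (inverseˡ h)) (enum-∈ B i)))))

  Q : ℕ
  Q = n / b

  block-step≡Q : ∀ {h} (h∈G : G h) {y} (y∈Bʰ : InImg h B y) → BlockThrough.q h∈G y∈Bʰ ≡ Q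
  block-step≡Q h∈G y∈Bʰ = sym (trans (cong (_/ b) (trans n≡bq (*-comm b q))) (m*n/n≡m q b))
    where open BlockThrough h∈G y∈Bʰ

  n≡bQ : n ≡ b * Q
  n≡bQ = let h , h∈G , y∈Bʰ = in-some-block u in
    trans (BlockThrough.n≡bq h∈G y∈Bʰ) (cong (b *_) (block-step≡Q h∈G y∈Bʰ))

  in-block⇔Q∣ : ∀ {h} → G h → ∀ {y} → InImg h B y → ∀ j → InImg h B (a ^ j · y) ⇔ Q ∣ j
  in-block⇔Q∣ {h} h∈G {y} y∈Bʰ j =
    subst (λ q → InImg h B (a ^ j · y) ⇔ q ∣ j) (block-step≡Q h∈G y∈Bʰ) (BlockThrough.hits⇔q∣ h∈G y∈Bʰ j)

  SB⇒a^Q : ∀ {x y} → SB x y → ∃[ t ] a ^ (t * Q) · x ≡ y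
  SB⇒a^Q {x} {y} (h , h∈G , x∈Bʰ , y∈Bʰ) = _∣_.quotient Q∣j , trans (cong (λ r → a ^ r · x) (sym (_∣_.equality Q∣j))) (proj₂ x→y)
    where
    x→y : InOrbit a x y
    x→y = block-in-a-orbit h∈G x∈Bʰ y∈Bʰ
    Q∣j : Q ∣ proj₁ x→y
    Q∣j = to (in-block⇔Q∣ h∈G x∈Bʰ (proj₁ x→y)) (subst (InImg h B) (sym (proj₂ x→y)) y∈Bʰ)

  SB⇒a-orbit : ∀ {x y} → SB x y → InOrbit a x y
  SB⇒a-orbit x~y = proj₁ (SB⇒a^Q x~y) * Q , proj₂ (SB⇒a^Q x~y)

  a^Q-SB : ∀ x t → SB x (a ^ (t * Q) · x)
  a^Q-SB x t = let h , h∈G , x∈Bʰ = in-some-block x in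
    h , h∈G , x∈Bʰ , from (in-block⇔Q∣ h∈G x∈Bʰ (t * Q)) (divides t refl)

  -- Γ covers Γ/𝓑

  3≤Q : 3 ≤ Q
  3≤Q = ≰⇒> λ Q≤2 → <-irrefl refl (<-≤-trans B-small (begin
    n       ≡⟨ n≡bQ ⟩
    b * Q   ≤⟨ *-monoʳ-≤ b Q≤2 ⟩
    b * 2   ≡⟨ *-comm b 2 ⟩
    2 * b   ∎))
    where open ≤-Reasoning

  instance
    Q≢0 : NonZero Q
    Q≢0 = >-nonZero (<-≤-trans z<s 3≤Q)

  Q∣n : Q ∣ n
  Q∣n = divides b n≡bQ

  a^r-not-SB : ∀ x r → 0 < r → r < Q → ¬ SB x (a ^ r · x)
  a^r-not-SB x r 0<r r<Q x~aʳx = <-irrefl refl (<-≤-trans r<Q (∣⇒≤ {{>-nonZero 0<r}} Q∣r))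
    where
    t = proj₁ (SB⇒a^Q x~aʳx)
    Q∣r : Q ∣ r
    Q∣r = subst (Q ∣_) (trans (A.^-≡⇒%-≡ x (t * Q) r (proj₂ (SB⇒a^Q x~aʳx))) (m<n⇒m%n≡m (<-≤-trans r<Q (∣⇒≤ Q∣n))))
                (%-presˡ-∣ (divides t refl) Q∣n)

  a-inverseˡ : ∀ x → a ^ (n ∸ 1) · a ^ 1 · x ≡ x
  a-inverseˡ = A.^-cancel (n ∸ 1) 1 1 (trans (+-comm (n ∸ 1) 1) (trans (suc-pred n) (sym (+-identityʳ n))))

  a-inverseʳ : ∀ x → a ^ 1 · a ^ (n ∸ 1) · x ≡ x
  a-inverseʳ = A.^-cancel 1 (n ∸ 1) 1 (trans (suc-pred n) (sym (+-identityʳ n)))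

  CoverEdge : Vertex → Vertex → Set
  CoverEdge x y = ¬ SB x y × (∀ v → Adj Γ x v → SB v y → v ≡ y)

  u-cover-edge : CoverEdge u (a ^ 1 · u)
  u-cover-edge = a^r-not-SB u 1 z<s (<-≤-trans (s≤s z<s) 3≤Q) , λ v u~v v~au →
    [ (λ v≡au → v≡au) , (λ v≡a⁻¹u → ⊥-elim (a⁻¹u≁au (subst (λ t → SB t (a ^ 1 · u)) v≡a⁻¹u v~au))) ]′
    (Uₐ-neighbours (0 , refl) u~v (InOrbit-trans (1 , refl) (SB⇒a-orbit (SB-sym v~au))))
    where
    a⁻¹u≁au : ¬ SB (a ^ (n ∸ 1) · u) (a ^ 1 · u)
    a⁻¹u≁au x~y = a^r-not-SB (a ^ (n ∸ 1) · u) 2 z<s 3≤Q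
      (subst (SB _) (trans (sym (cong (a ^ 1 ·_) (a-inverseʳ u))) (sym (^-+ a 1 1 (a ^ (n ∸ 1) · u)))) x~y)

  au-cover-edge : CoverEdge (a ^ 1 · u) u
  au-cover-edge = (λ au~u → proj₁ u-cover-edge (SB-sym au~u)) , λ v au~v v~u →
    [ (λ v≡a²u → ⊥-elim (a^r-not-SB u 2 z<s 3≤Q (SB-sym (subst (λ t → SB t u) (trans v≡a²u (sym (^-+ a 1 1 u))) v~u))))
    , (λ v≡a⁻¹au → trans v≡a⁻¹au (a-inverseˡ u)) ]′
    (Uₐ-neighbours (1 , refl) au~v (SB⇒a-orbit (SB-sym v~u)))

  cover-edge-G : ∀ {g} → G g → ∀ {x y} → CoverEdge x y → CoverEdge (g ⟨$⟩ʳ x) (g ⟨$⟩ʳ y)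
  cover-edge-G {g} g∈G {x} {y} (x≁y , unique) =
    (λ gx~gy → x≁y (subst₂ SB (inverseˡ g) (inverseˡ g) (SB-G (G-inv g∈G) gx~gy))) ,
    λ v gx~v v~gy → trans (sym (inverseʳ g)) (cong (g ⟨$⟩ʳ_) (unique (g ⟨$⟩ˡ v)
      (subst (λ t → Adj Γ t (g ⟨$⟩ˡ v)) (inverseˡ g) (G-adj (G-inv g∈G) gx~v))
      (subst (SB (g ⟨$⟩ˡ v)) (inverseˡ g) (SB-G (G-inv g∈G) v~gy))))

  cover : IsCover Γ G B
  cover x y x~y with G-edge-transitive u (a ^ 1 · u) x y (Uₐ-adj (0 , refl)) x~y
  ... | g , g∈G , inj₁ (gu≡x , gau≡y) = subst₂ CoverEdge gu≡x gau≡y (cover-edge-G g∈G u-cover-edge)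
  ... | g , g∈G , inj₂ (gu≡y , gau≡x) = subst₂ CoverEdge gau≡x gu≡y (cover-edge-G g∈G au-cover-edge)

  -- The kernel of G on 𝓑

  Kernel : Permutation′ (2 * n) → Set
  Kernel = InKernel G B

  kernel-same-block : ∀ {g} → Kernel g → ∀ x → SB x (g ⟨$⟩ʳ x)
  kernel-same-block {g} (_ , preserves) x = let h , h∈G , x∈Bʰ = in-some-block x in
    h , h∈G , x∈Bʰ , to (preserves h h∈G x) x∈Bʰ

  kernel-fixes-neighbour : ∀ {g} → Kernel g → ∀ {x y} → g ⟨$⟩ʳ x ≡ x → Adj Γ x y → g ⟨$⟩ʳ y ≡ y
  kernel-fixes-neighbour {g} g∈K {x} {y} gx≡x x~y =
    proj₂ (cover x y x~y) (g ⟨$⟩ʳ y) (subst (λ t → Adj Γ t (g ⟨$⟩ʳ y)) gx≡x (G-adj (proj₁ g∈K) x~y))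
          (SB-sym (kernel-same-block g∈K y))

  u-has-W-neighbour : ∃[ v ] InOrbit a w v × Adj Γ u v
  u-has-W-neighbour with Finₚ.any? (λ v → (adj Γ u v ≟ᵇ true) ×-dec (¬? (v Finₚ.≟ a ^ 1 · u) ×-dec ¬? (v Finₚ.≟ a ^ (n ∸ 1) · u)))
  ... | yes (v , u~v , v≢au , v≢a⁻¹u) =
    v , [ (λ v∈Uₐ → ⊥-elim ([ v≢au , v≢a⁻¹u ]′ (Uₐ-neighbours (0 , refl) u~v v∈Uₐ))) , (λ v∈Wₐ → v∈Wₐ) ]′ (proj₂ a-orbits v) , u~v
  ... | no ∄v = ⊥-elim (<-irrefl refl (<-≤-trans (≤-trans (s≤s (s≤s (s≤s z≤n))) 6≤d)
                  (subst (_≤ 2) (proj₁ Γ∈F u) (⊆pair⇒∣p∣≤2 (tabulate (adj Γ u)) (a ^ 1 · u) (a ^ (n ∸ 1) · u) pair))))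
    where
    pair : ∀ x → x ∈ tabulate (adj Γ u) → x ≡ a ^ 1 · u ⊎ x ≡ a ^ (n ∸ 1) · u
    pair x x∈N with x Finₚ.≟ a ^ 1 · u | x Finₚ.≟ a ^ (n ∸ 1) · u
    ... | yes x≡au | _           = inj₁ x≡au
    ... | no _     | yes x≡a⁻¹u  = inj₂ x≡a⁻¹u
    ... | no x≢au  | no x≢a⁻¹u   = ⊥-elim (∄v (x , to (∈-tabulate⇔ (adj Γ u) x) x∈N , x≢au , x≢a⁻¹u))

  W-has-Uₐ-neighbour : ∀ {y} → InOrbit a w y → ∃[ x ] Uₐ x × Adj Γ y x
  W-has-Uₐ-neighbour {y} (k , aᵏw≡y) = a ^ t · u , (t , refl) ,
    adj-sym (subst (Adj Γ (a ^ t · u)) aᵗv≡y (G-adj (a^-closed t) (proj₂ (proj₂ u-has-W-neighbour))))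
    where
    v = proj₁ u-has-W-neighbour
    w→v = proj₁ (proj₂ u-has-W-neighbour)
    t = k + (n ∸ 1) * proj₁ w→v
    aᵗv≡y : a ^ t · v ≡ y
    aᵗv≡y = begin
      a ^ t · v                                  ≡⟨ ^-+ a k _ v ⟩
      a ^ k · a ^ ((n ∸ 1) * proj₁ w→v) · v      ≡⟨ cong (λ z → a ^ k · a ^ ((n ∸ 1) * proj₁ w→v) · z) (proj₂ w→v) ⟨
      a ^ k · a ^ ((n ∸ 1) * proj₁ w→v) · _      ≡⟨ cong (a ^ k ·_) (A.^-inverseˡ (proj₁ w→v) w) ⟩
      a ^ k · w                                  ≡⟨ aᵏw≡y ⟩
      y                                          ∎
      where open ≡-Reasoning

  kernel-fixes-Uₐ : ∀ {g} → Kernel g → ∀ {x₀} → Uₐ x₀ → g ⟨$⟩ʳ x₀ ≡ x₀ → ∀ {y} → Uₐ y → g ⟨$⟩ʳ y ≡ y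
  kernel-fixes-Uₐ {g} g∈K {x₀} x₀∈Uₐ gx₀≡x₀ y∈Uₐ =
    let k , aᵏx₀≡y = InOrbit-trans (A.InOrbit-sym x₀∈Uₐ) y∈Uₐ in subst (λ t → g ⟨$⟩ʳ t ≡ t) aᵏx₀≡y (walk k)
    where
    walk : ∀ k → g ⟨$⟩ʳ (a ^ k · x₀) ≡ a ^ k · x₀
    walk zero    = gx₀≡x₀
    walk (suc k) = subst (λ t → g ⟨$⟩ʳ t ≡ t) (sym (^-+ a 1 k x₀))
      (kernel-fixes-neighbour g∈K (walk k) (Uₐ-adj (InOrbit-trans x₀∈Uₐ (k , refl))))

  kernel-semiregular : ∀ {g} → Kernel g → ∀ {y₀} → g ⟨$⟩ʳ y₀ ≡ y₀ → ∀ y → g ⟨$⟩ʳ y ≡ y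
  kernel-semiregular {g} g∈K {y₀} gy₀≡y₀ =
    [ (λ y₀∈Uₐ → from-Uₐ y₀∈Uₐ gy₀≡y₀)
    , (λ y₀∈Wₐ → let x , x∈Uₐ , y₀~x = W-has-Uₐ-neighbour y₀∈Wₐ in from-Uₐ x∈Uₐ (kernel-fixes-neighbour g∈K gy₀≡y₀ y₀~x)) ]′
    (proj₂ a-orbits y₀)
    where
    from-Uₐ : ∀ {x₀} → Uₐ x₀ → g ⟨$⟩ʳ x₀ ≡ x₀ → ∀ y → g ⟨$⟩ʳ y ≡ y
    from-Uₐ x₀∈Uₐ gx₀≡x₀ y =
      [ kernel-fixes-Uₐ g∈K x₀∈Uₐ gx₀≡x₀
      , (λ y∈Wₐ → let x , x∈Uₐ , y~x = W-has-Uₐ-neighbour y∈Wₐ in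
                   kernel-fixes-neighbour g∈K (kernel-fixes-Uₐ g∈K x₀∈Uₐ gx₀≡x₀ x∈Uₐ) (adj-sym y~x)) ]′
      (proj₂ a-orbits y)

  kernel-resp : ∀ {g g′} → g Perm.≈ g′ → Kernel g → Kernel g′
  kernel-resp {g} {g′} g≈g′ (g∈G , preserves) = IsPermGroup.resp G-group g g′ g≈g′ g∈G ,
    λ h h∈G x → subst (λ t → InImg h B x ⇔ InImg h B t) (g≈g′ x) (preserves h h∈G x)

  kernel-comp : ∀ {g k} → Kernel g → Kernel k → Kernel (g ∘ₚ k)
  kernel-comp {g} (g∈G , g-preserves) (k∈G , k-preserves) = G-comp g∈G k∈G , λ h h∈G x → mk⇔
    (λ x∈Bʰ → to (k-preserves h h∈G (g ⟨$⟩ʳ x)) (to (g-preserves h h∈G x) x∈Bʰ))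
    (λ gkx∈Bʰ → from (g-preserves h h∈G x) (from (k-preserves h h∈G (g ⟨$⟩ʳ x)) gkx∈Bʰ))

  kernel-a^Q : ∀ t → Kernel (pow a (t * Q))
  kernel-a^Q t = a^-closed (t * Q) , λ h h∈G x →
    mk⇔ (SB-in-image (a^Q-SB x t) h∈G) (SB-in-image (SB-sym (a^Q-SB x t)) h∈G)

  kernel⇒setwise-stabiliser : ∀ {g} → Kernel g → InSetwiseStab c B g
  kernel⇒setwise-stabiliser {g} g∈K@(_ , preserves) = (tQ * s , λ y → trans (g≡a^tQ y) (a^≡c^ tQ y)) , preserves Perm.id G-id
    where
    G-id = IsPermGroup.has-id G-group
    z₀ = proj₁ B-point
    z₀~gz₀ = SB⇒a^Q (kernel-same-block g∈K z₀)
    t = proj₁ z₀~gz₀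
    tQ = t * Q
    a⁻ᵗᑫ∈K : Kernel (pow a ((n ∸ 1) * tQ))
    a⁻ᵗᑫ∈K = kernel-resp (λ y → cong (λ r → a ^ r · y) (*-assoc (n ∸ 1) t Q)) (kernel-a^Q ((n ∸ 1) * t))
    ga⁻ᵗᑫ≡id : ∀ y → a ^ ((n ∸ 1) * tQ) · (g ⟨$⟩ʳ y) ≡ y
    ga⁻ᵗᑫ≡id = kernel-semiregular (kernel-comp g∈K a⁻ᵗᑫ∈K)
      (trans (cong (a ^ ((n ∸ 1) * tQ) ·_) (sym (proj₂ z₀~gz₀))) (A.^-inverseˡ tQ z₀))
    g≡a^tQ : ∀ y → g ⟨$⟩ʳ y ≡ a ^ tQ · y
    g≡a^tQ y = trans (sym (A.^-inverseʳ tQ (g ⟨$⟩ʳ y))) (cong (a ^ tQ ·_) (ga⁻ᵗᑫ≡id y))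

  setwise-stabiliser⇒kernel : ∀ {g} → InSetwiseStab c B g → Kernel g
  setwise-stabiliser⇒kernel {g} ((k , g≈cᵏ) , stabilises) =
    kernel-resp (λ y → trans (cong (λ r → a ^ r · y) (sym (_∣_.equality Q∣j))) (sym (g≡a^j y))) (kernel-a^Q (_∣_.quotient Q∣j))
    where
    j = k * proj₁ c∈⟨a⟩
    g≡a^j : ∀ y → g ⟨$⟩ʳ y ≡ a ^ j · y
    g≡a^j y = trans (g≈cᵏ y) (c^≡a^ k y)
    Q∣j : Q ∣ j
    Q∣j = to (in-block⇔Q∣ (IsPermGroup.has-id G-group) (proj₂ B-point) j)
             (subst (_∈ B) (g≡a^j (proj₁ B-point)) (to (stabilises (proj₁ B-point)) (proj₂ B-point)))

  kernel≡setwise-stabiliser : ∀ g → InKernel G B g ⇔ InSetwiseStab c B g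
  kernel≡setwise-stabiliser g = mk⇔ kernel⇒setwise-stabiliser setwise-stabiliser⇒kernel

  kernel-group : IsPermGroup Kernel
  kernel-group = record
    { resp   = λ _ _ → kernel-resp
    ; has-id = IsPermGroup.has-id G-group , λ _ _ _ → mk⇔ (λ x∈Bʰ → x∈Bʰ) (λ x∈Bʰ → x∈Bʰ)
    ; comp   = λ _ _ → kernel-comp
    ; inv    = λ g (g∈G , preserves) → G-inv g∈G , λ h h∈G x → mk⇔
        (λ x∈Bʰ → from (preserves h h∈G (g ⟨$⟩ˡ x)) (subst (InImg h B) (sym (inverseʳ g)) x∈Bʰ))
        (λ g⁻¹x∈Bʰ → subst (InImg h B) (inverseʳ g) (to (preserves h h∈G (g ⟨$⟩ˡ x)) g⁻¹x∈Bʰ))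
    }

  kernel-normal : ∀ g k → G g → Kernel k → Kernel (Perm.flip g ∘ₚ (k ∘ₚ g))
  kernel-normal g k g∈G (k∈G , preserves) = G-comp (G-inv g∈G) (G-comp k∈G g∈G) , λ h h∈G x → mk⇔
    (λ x∈Bʰ → to (preserves (h ∘ₚ Perm.flip g) (G-comp h∈G (G-inv g∈G)) (g ⟨$⟩ˡ x))
                 (subst (_∈ B) (cong (h ⟨$⟩ˡ_) (sym (inverseʳ g))) x∈Bʰ))
    (λ y∈Bʰ → subst (_∈ B) (cong (h ⟨$⟩ˡ_) (inverseʳ g))
                (from (preserves (h ∘ₚ Perm.flip g) (G-comp h∈G (G-inv g∈G)) (g ⟨$⟩ˡ x)) y∈Bʰ))

  kernel-orbit⇒SB : ∀ {x y} → (Σ _ λ k → Kernel k × k ⟨$⟩ʳ x ≡ y) → SB x y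
  kernel-orbit⇒SB {x} (k , k∈K , kx≡y) = subst (SB x) kx≡y (kernel-same-block k∈K x)

  SB⇒kernel-orbit : ∀ {x y} → SB x y → Σ _ λ k → Kernel k × k ⟨$⟩ʳ x ≡ y
  SB⇒kernel-orbit x~y = pow a (proj₁ (SB⇒a^Q x~y) * Q) , kernel-a^Q (proj₁ (SB⇒a^Q x~y)) , proj₂ (SB⇒a^Q x~y)

  normal-cover : IsNormalCover Γ G B
  normal-cover = cover , Kernel , kernel-group , (λ _ → proj₁) , kernel-normal , λ x y → mk⇔ SB⇒kernel-orbit kernel-orbit⇒SB

  -- The quotient graph

  M : ℕ
  M = Q + Q

  residue : ℕ → Fin Q
  residue k = fromℕ< (m%n<n k Q)

  residue-cong : ∀ {k k′} → k % Q ≡ k′ % Q → residue k ≡ residue k′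
  residue-cong {k} {k′} eq = Finₚ.fromℕ<-cong _ _ eq (m%n<n k Q) (m%n<n k′ Q)

  residue-injective : ∀ {k k′} → residue k ≡ residue k′ → k % Q ≡ k′ % Q
  residue-injective {k} {k′} eq =
    trans (sym (Finₚ.toℕ-fromℕ< (m%n<n k Q))) (trans (cong toℕ eq) (Finₚ.toℕ-fromℕ< (m%n<n k′ Q)))

  residue-toℕ : ∀ (r : Fin Q) → residue (toℕ r) ≡ r
  residue-toℕ r = trans (Finₚ.fromℕ<-cong _ _ (m<n⇒m%n≡m (Finₚ.toℕ<n r)) _ (Finₚ.toℕ<n r)) (Finₚ.fromℕ<-toℕ r (Finₚ.toℕ<n r))

  %n≡⇒%Q≡ : ∀ {k k′} → k % n ≡ k′ % n → k % Q ≡ k′ % Q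
  %n≡⇒%Q≡ {k} {k′} eq = trans (sym (m∣n⇒o%n%m≡o%m Q n k Q∣n)) (trans (cong (_% Q) eq) (m∣n⇒o%n%m≡o%m Q n k′ Q∣n))

  coordinates : ∀ {v} → Uₐ v ⊎ InOrbit a w v → Fin Q ⊎ Fin Q
  coordinates = Sum.map (λ (k , _) → residue k) (λ (k , _) → residue k)

  -- a^k u is labelled k mod Q in the left copy of Fin Q, a^k w the same in the right copy.
  π : Vertex → Fin M
  π v = join Q Q (coordinates (proj₂ a-orbits v))

  u-not-to-w : ∀ k k′ → a ^ k′ · w ≢ a ^ k · u
  u-not-to-w k k′ eq = proj₁ a-orbits (InOrbit-trans (k , refl) (A.InOrbit-sym (k′ , eq)))

  π-a^u : ∀ k → π (a ^ k · u) ≡ join Q Q (inj₁ (residue k))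
  π-a^u k = cong (join Q Q) (coordinates-a^u (proj₂ a-orbits (a ^ k · u)))
    where
    coordinates-a^u : (o : Uₐ (a ^ k · u) ⊎ InOrbit a w (a ^ k · u)) → coordinates o ≡ inj₁ (residue k)
    coordinates-a^u (inj₁ (k′ , eq)) = cong inj₁ (residue-cong (%n≡⇒%Q≡ (A.^-≡⇒%-≡ u k′ k eq)))
    coordinates-a^u (inj₂ (k′ , eq)) = ⊥-elim (u-not-to-w k k′ eq)

  π-a^w : ∀ k → π (a ^ k · w) ≡ join Q Q (inj₂ (residue k))
  π-a^w k = cong (join Q Q) (coordinates-a^w (proj₂ a-orbits (a ^ k · w)))
    where
    coordinates-a^w : (o : Uₐ (a ^ k · w) ⊎ InOrbit a w (a ^ k · w)) → coordinates o ≡ inj₂ (residue k)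
    coordinates-a^w (inj₁ (k′ , eq)) = ⊥-elim (u-not-to-w k′ k (sym eq))
    coordinates-a^w (inj₂ (k′ , eq)) = cong inj₂ (residue-cong (%n≡⇒%Q≡ (A.^-≡⇒%-≡ w k′ k eq)))

  SB-mod : ∀ x {k k′} → k % Q ≡ k′ % Q → SB (a ^ k · x) (a ^ k′ · x)
  SB-mod x {k} {k′} eq = SB-trans (SB-sym (subst (λ r → SB (a ^ r · x) (a ^ k · x)) eq (SB-residue k))) (SB-residue k′)
    where
    SB-residue : ∀ k → SB (a ^ (k % Q) · x) (a ^ k · x)
    SB-residue k = subst (SB (a ^ (k % Q) · x))
      (trans (sym (^-+ a ((k / Q) * Q) (k % Q) x))
             (cong (λ t → a ^ t · x) (trans (+-comm ((k / Q) * Q) (k % Q)) (sym (m≡m%n+[m/n]*n k Q)))))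
      (a^Q-SB (a ^ (k % Q) · x) (k / Q))

  module OnOrbit (base : Vertex) (tag : Fin Q → Fin Q ⊎ Fin Q) (tag-injective : Injective _≡_ _≡_ tag)
                 (π-a^ : ∀ k → π (a ^ k · base) ≡ join Q Q (tag (residue k))) where

    π-a^-cong : ∀ {k k′} → k % Q ≡ k′ % Q → π (a ^ k · base) ≡ π (a ^ k′ · base)
    π-a^-cong eq = trans (π-a^ _) (trans (cong (λ r → join Q Q (tag r)) (residue-cong eq)) (sym (π-a^ _)))

    π-a^-injective : ∀ {k k′} → π (a ^ k · base) ≡ π (a ^ k′ · base) → k % Q ≡ k′ % Q
    π-a^-injective eq = residue-injective (tag-injective (join-injective Q Q (trans (sym (π-a^ _)) (trans eq (π-a^ _)))))

    SB⇒π≡ : ∀ {x y} → InOrbit a base x → SB x y → π x ≡ π y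
    SB⇒π≡ (k , refl) x~y = let t , aᵗᑫx≡y = SB⇒a^Q x~y in
      trans (π-a^-cong (sym ([m+kn]%n≡m%n k t Q)))
            (cong π (trans (cong (λ r → a ^ r · base) (+-comm k (t * Q))) (trans (^-+ a (t * Q) k base) aᵗᑫx≡y)))

  module OnU = OnOrbit u inj₁ inj₁-injective π-a^u
  module OnW = OnOrbit w inj₂ inj₂-injective π-a^w

  SB⇒π≡ : ∀ {x y} → SB x y → π x ≡ π y
  SB⇒π≡ {x} x~y = [ (λ x∈Uₐ → OnU.SB⇒π≡ x∈Uₐ x~y) , (λ x∈Wₐ → OnW.SB⇒π≡ x∈Wₐ x~y) ]′ (proj₂ a-orbits x)

  π-sides-differ : ∀ k k′ → π (a ^ k · u) ≢ π (a ^ k′ · w)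
  π-sides-differ k k′ eq =
    inj₁≢inj₂ (join-injective Q Q {inj₁ (residue k)} {inj₂ (residue k′)} (trans (sym (π-a^u k)) (trans eq (π-a^w k′))))

  π≡⇒SB : ∀ {x y} → π x ≡ π y → SB x y
  π≡⇒SB {x} {y} πx≡πy = cases (proj₂ a-orbits x) (proj₂ a-orbits y)
    where
    cases : Uₐ x ⊎ InOrbit a w x → Uₐ y ⊎ InOrbit a w y → SB x y
    cases (inj₁ (k , refl)) (inj₁ (k′ , refl)) = SB-mod u (OnU.π-a^-injective {k} {k′} πx≡πy)
    cases (inj₂ (k , refl)) (inj₂ (k′ , refl)) = SB-mod w (OnW.π-a^-injective {k} {k′} πx≡πy)
    cases (inj₁ (k , refl)) (inj₂ (k′ , refl)) = ⊥-elim (π-sides-differ k k′ πx≡πy)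
    cases (inj₂ (k , refl)) (inj₁ (k′ , refl)) = ⊥-elim (π-sides-differ k′ k (sym πx≡πy))

  π≡⇔SB : ∀ x y → (π x ≡ π y) ⇔ SB x y
  π≡⇔SB x y = mk⇔ π≡⇒SB SB⇒π≡

  π-surjective : ∀ i → ∃[ x ] π x ≡ i
  π-surjective i = let x , πx≡ = lift (splitAt Q i) in x , trans πx≡ (Finₚ.join-splitAt Q Q i)
    where
    lift : (s : Fin Q ⊎ Fin Q) → ∃[ x ] π x ≡ join Q Q s
    lift (inj₁ r) = a ^ toℕ r · u , trans (π-a^u (toℕ r)) (cong (λ r′ → join Q Q (inj₁ r′)) (residue-toℕ r))
    lift (inj₂ r) = a ^ toℕ r · w , trans (π-a^w (toℕ r)) (cong (λ r′ → join Q Q (inj₂ r′)) (residue-toℕ r))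

  QuotientEdge : Fin M → Fin M → Set
  QuotientEdge i j = i ≢ j × Σ Vertex λ x → Σ Vertex λ y → π x ≡ i × π y ≡ j × Adj Γ x y

  quotient-edge? : ∀ i j → Dec (QuotientEdge i j)
  quotient-edge? i j = ¬? (i Finₚ.≟ j) ×-dec Finₚ.any? λ x → Finₚ.any? λ y →
    (π x Finₚ.≟ i) ×-dec (π y Finₚ.≟ j) ×-dec (adj Γ x y ≟ᵇ true)

  QuotientEdge-sym : ∀ {i j} → QuotientEdge i j → QuotientEdge j i
  QuotientEdge-sym (i≢j , x , y , πx≡i , πy≡j , x~y) = (λ j≡i → i≢j (sym j≡i)) , y , x , πy≡j , πx≡i , adj-sym x~y

  Δ : Graph M
  Δ = record
    { adj   = λ i j → does (quotient-edge? i j)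
    ; sym   = λ i j → does-cong (mk⇔ QuotientEdge-sym QuotientEdge-sym) (quotient-edge? i j) (quotient-edge? j i)
    ; irref = λ i → dec-false (quotient-edge? i i) (λ (i≢i , _) → i≢i refl)
    }

  Δ-adj⇔ : ∀ i j → Adj Δ i j ⇔ QuotientEdge i j
  Δ-adj⇔ i j = mk⇔ (does≡true⇒ (quotient-edge? i j)) (dec-true (quotient-edge? i j))

  is-quotient : IsQuotient Γ G B Δ π
  is-quotient = π-surjective , π≡⇔SB , Δ-adj⇔

  Δ-regular : Regular d Δ
  Δ-regular i = trans (∣p∣≡-enumeration (tabulate (adj Δ i)) (λ k → π (nbr k)) π-nbr-injective π-nbr-adj π-nbr-onto)
                      (proj₁ Γ∈F x)
    where
    x = proj₁ (π-surjective i)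
    πx≡i = proj₂ (π-surjective i)
    nbr = enum (tabulate (adj Γ x))
    x~nbr : ∀ k → Adj Γ x (nbr k)
    x~nbr k = to (∈-tabulate⇔ (adj Γ x) (nbr k)) (enum-∈ _ k)
    π-nbr-adj : ∀ k → π (nbr k) ∈ tabulate (adj Δ i)
    π-nbr-adj k = from (∈-tabulate⇔ (adj Δ i) (π (nbr k))) (from (Δ-adj⇔ i (π (nbr k)))
      ((λ i≡ → proj₁ (cover x (nbr k) (x~nbr k)) (π≡⇒SB (trans πx≡i i≡))) , x , nbr k , πx≡i , refl , x~nbr k))
    π-nbr-injective : Injective _≡_ _≡_ (λ k → π (nbr k))
    π-nbr-injective {k} {k′} eq = enum-injective _ (proj₂ (cover x (nbr k′) (x~nbr k′)) (nbr k) (x~nbr k) (π≡⇒SB eq))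
    π-nbr-onto : ∀ j → j ∈ tabulate (adj Δ i) → ∃[ k ] π (nbr k) ≡ j
    π-nbr-onto j j∈N = let k , nbrk≡y = enum-surjective _ (from (∈-tabulate⇔ (adj Γ x) y) x~y) in
      k , trans (cong π nbrk≡y) (trans (sym (SB⇒π≡ (a^Q-SB y′ t))) πy′≡j)
      where
      edge = to (Δ-adj⇔ i j) (to (∈-tabulate⇔ (adj Δ i) j) j∈N)
      x′ = proj₁ (proj₂ edge)
      y′ = proj₁ (proj₂ (proj₂ edge))
      πy′≡j = proj₁ (proj₂ (proj₂ (proj₂ (proj₂ edge))))
      x′~x = SB⇒a^Q (π≡⇒SB (trans (proj₁ (proj₂ (proj₂ (proj₂ edge)))) (sym πx≡i)))
      t = proj₁ x′~x
      y = a ^ (t * Q) · y′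
      x~y : Adj Γ x y
      x~y = subst (λ z → Adj Γ z y) (proj₂ x′~x) (G-adj (a^-closed (t * Q)) (proj₂ (proj₂ (proj₂ (proj₂ (proj₂ edge))))))

  rep : Fin M → Vertex
  rep i = proj₁ (π-surjective i)

  π-a^-rep : ∀ k x → π (a ^ k · rep (π x)) ≡ π (a ^ k · x)
  π-a^-rep k x = SB⇒π≡ (SB-G (a^-closed k) (π≡⇒SB (proj₂ (π-surjective (π x)))))

  ρ : Permutation′ M
  ρ = Perm.permutation (λ i → π (a ^ 1 · rep i)) (λ i → π (a ^ (n ∸ 1) · rep i))
    (λ i → trans (π-a^-rep 1 _) (trans (cong π (a-inverseʳ (rep i))) (proj₂ (π-surjective i))))
    (λ i → trans (π-a^-rep (n ∸ 1) _) (trans (cong π (a-inverseˡ (rep i))) (proj₂ (π-surjective i))))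

  ρ-π : ∀ x → ρ ⟨$⟩ʳ π x ≡ π (a ^ 1 · x)
  ρ-π = π-a^-rep 1

  ρ^-π : ∀ k x → ρ ^ k · π x ≡ π (a ^ k · x)
  ρ^-π zero    x = refl
  ρ^-π (suc k) x = trans (cong (ρ ^ k ·_) (ρ-π x))
    (trans (ρ^-π k (a ^ 1 · x)) (cong π (trans (sym (^-+ a k 1 x)) (cong (λ t → a ^ t · x) (+-comm k 1)))))

  ρ-injective : ∀ {i j} → ρ ⟨$⟩ʳ i ≡ ρ ⟨$⟩ʳ j → i ≡ j
  ρ-injective = ^-injective ρ 1

  ρ-aut : IsAut Δ ρ
  ρ-aut i j = does-cong (mk⇔ backward forward) (quotient-edge? (ρ ⟨$⟩ʳ i) (ρ ⟨$⟩ʳ j)) (quotient-edge? i j)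
    where
    forward : QuotientEdge i j → QuotientEdge (ρ ⟨$⟩ʳ i) (ρ ⟨$⟩ʳ j)
    forward (i≢j , x , y , πx≡i , πy≡j , x~y) = (λ eq → i≢j (ρ-injective eq)) , a ^ 1 · x , a ^ 1 · y ,
      trans (sym (ρ-π x)) (cong (ρ ⟨$⟩ʳ_) πx≡i) , trans (sym (ρ-π y)) (cong (ρ ⟨$⟩ʳ_) πy≡j) , G-adj (a^-closed 1) x~y
    backward : QuotientEdge (ρ ⟨$⟩ʳ i) (ρ ⟨$⟩ʳ j) → QuotientEdge i j
    backward (ρi≢ρj , x , y , πx≡ρi , πy≡ρj , x~y) = (λ eq → ρi≢ρj (cong (ρ ⟨$⟩ʳ_) eq)) ,
      a ^ (n ∸ 1) · x , a ^ (n ∸ 1) · y ,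
      ρ-injective (trans (ρ-π _) (trans (cong π (a-inverseʳ x)) πx≡ρi)) ,
      ρ-injective (trans (ρ-π _) (trans (cong π (a-inverseʳ y)) πy≡ρj)) ,
      G-adj (a^-closed (n ∸ 1)) x~y

  ρ-orbits : TwoOrbits ρ (π u) (π w)
  ρ-orbits = πu↛πw , λ i → Sum.map (on-orbit i) (on-orbit i) (proj₂ a-orbits (rep i))
    where
    on-orbit : ∀ {base} i → InOrbit a base (rep i) → InOrbit ρ (π base) i
    on-orbit {base} i (k , aᵏb≡rep) = k , trans (ρ^-π k base) (trans (cong π aᵏb≡rep) (proj₂ (π-surjective i)))
    πu↛πw : ¬ InOrbit ρ (π u) (π w)
    πu↛πw (k , ρᵏπu≡πw) = proj₁ a-orbits (InOrbit-trans (k , refl) (SB⇒a-orbit (π≡⇒SB (trans (sym (ρ^-π k u)) ρᵏπu≡πw))))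

  module ΔOrbit (base : Vertex)
                (π-a^-cong : ∀ {k k′} → k % Q ≡ k′ % Q → π (a ^ k · base) ≡ π (a ^ k′ · base))
                (π-a^-injective : ∀ {k k′} → π (a ^ k · base) ≡ π (a ^ k′ · base) → k % Q ≡ k′ % Q) where

    vertex : Fin Q → Fin M
    vertex r = π (a ^ toℕ r · base)

    vertex-injective : Injective _≡_ _≡_ vertex
    vertex-injective {r} {r′} eq = Finₚ.toℕ-injective
      (trans (sym (m<n⇒m%n≡m (Finₚ.toℕ<n r))) (trans (π-a^-injective eq) (m<n⇒m%n≡m (Finₚ.toℕ<n r′))))

    vertex-image : ∀ i → InOrbit ρ (π base) i ⇔ (∃[ r ] vertex r ≡ i)
    vertex-image i = mk⇔
      (λ (k , ρᵏπb≡i) → fromℕ< (m%n<n k Q) ,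
        trans (cong (λ t → π (a ^ t · base)) (Finₚ.toℕ-fromℕ< (m%n<n k Q)))
              (trans (π-a^-cong (m%n%n≡m%n k Q)) (trans (sym (ρ^-π k base)) ρᵏπb≡i)))
      (λ (r , vr≡i) → toℕ r , trans (ρ^-π (toℕ r) base) vr≡i)

    orbit-size : HasSize Q (InOrbit ρ (π base))
    orbit-size = vertex , vertex-injective , vertex-image

  module ΔU = ΔOrbit u OnU.π-a^-cong OnU.π-a^-injective
  module ΔW = ΔOrbit w OnW.π-a^-cong OnW.π-a^-injective

  consecutive-edge : ∀ r → QuotientEdge (π (a ^ r · u)) (π (a ^ suc r · u))
  consecutive-edge r = (λ eq → a^r-not-SB x 1 z<s (<-≤-trans (s≤s z<s) 3≤Q) (subst (SB x) (^-+ a 1 r u) (π≡⇒SB eq))) ,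
    x , a ^ 1 · x , refl , cong π (sym (^-+ a 1 r u)) , Uₐ-adj (r , refl)
    where x = a ^ r · u

  CycSucc⇒π≡ : ∀ {r r′} → CycSucc Q r r′ → π (a ^ r′ · u) ≡ π (a ^ suc r · u)
  CycSucc⇒π≡ r→r′ = OnU.π-a^-cong (CycSucc⇒%≡suc {m = Q} r→r′)

  a-step⇒%≡suc : ∀ r r′ {x y} → π x ≡ π (a ^ r · u) → π y ≡ π (a ^ r′ · u) → y ≡ a ^ 1 · x → r′ % Q ≡ suc r % Q
  a-step⇒%≡suc r r′ {x} {y} πx≡ πy≡ y≡ax = OnU.π-a^-injective (begin
    π (a ^ r′ · u)        ≡⟨ πy≡ ⟨
    π y                   ≡⟨ cong π y≡ax ⟩
    π (a ^ 1 · x)         ≡⟨ SB⇒π≡ (SB-G (a^-closed 1) (π≡⇒SB πx≡)) ⟩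
    π (a ^ 1 · a ^ r · u) ≡⟨ cong π (^-+ a 1 r u) ⟨
    π (a ^ suc r · u)     ∎)
    where open ≡-Reasoning

  π≡⇒Uₐ : ∀ r {x} → π x ≡ π (a ^ r · u) → Uₐ x
  π≡⇒Uₐ r πx≡ = InOrbit-trans (r , refl) (SB⇒a-orbit (π≡⇒SB (sym πx≡)))

  Δ-cycle-adj : ∀ r r′ → Adj Δ (ΔU.vertex r) (ΔU.vertex r′) ⇔ CycAdj Q (toℕ r) (toℕ r′)
  Δ-cycle-adj r r′ = mk⇔ (λ adj → forward (to (Δ-adj⇔ i j) adj)) (λ cyc-adj → from (Δ-adj⇔ i j) (backward cyc-adj))
    where
    i = ΔU.vertex r
    j = ΔU.vertex r′
    backward : CycAdj Q (toℕ r) (toℕ r′) → QuotientEdge i j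
    backward (inj₁ r→r′) = subst (QuotientEdge i) (sym (CycSucc⇒π≡ r→r′)) (consecutive-edge (toℕ r))
    backward (inj₂ r′→r) = QuotientEdge-sym (subst (QuotientEdge j) (sym (CycSucc⇒π≡ r′→r)) (consecutive-edge (toℕ r′)))
    forward : QuotientEdge i j → CycAdj Q (toℕ r) (toℕ r′)
    forward (_ , x , y , πx≡ , πy≡ , x~y) =
      [ (λ y≡ax → inj₁ (%≡suc⇒CycSucc {m = Q} (Finₚ.toℕ<n r) (Finₚ.toℕ<n r′) (a-step⇒%≡suc (toℕ r) (toℕ r′) πx≡ πy≡ y≡ax)))
      , (λ y≡a⁻¹x → inj₂ (%≡suc⇒CycSucc {m = Q} (Finₚ.toℕ<n r′) (Finₚ.toℕ<n r)
          (a-step⇒%≡suc (toℕ r′) (toℕ r) πy≡ πx≡ (trans (sym (a-inverseʳ x)) (cong (a ^ 1 ·_) (sym y≡a⁻¹x)))))) ]′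
      (Uₐ-neighbours (π≡⇒Uₐ (toℕ r) πx≡) x~y (π≡⇒Uₐ (toℕ r′) πy≡))

  Δ-cycle : InducesCycle Δ (InOrbit ρ (π u))
  Δ-cycle = Q , 3≤Q , ΔU.vertex , ΔU.vertex-injective , ΔU.vertex-image , Δ-cycle-adj

  Δ∈F : InF d Δ
  Δ∈F = Δ-regular , ρ , ρ-aut , π u , π w , ρ-orbits , (Q , ΔU.orbit-size , ΔW.orbit-size) , inj₁ Δ-cycle

lemma4p1 : (d n : ℕ) → 6 ≤ d → (Γ : Graph (2 * n)) → InF d Γ →
    (G : Permutation′ (2 * n) → Set) → IsAutGroup Γ G → EdgeTransitive Γ G →
    (c : Permutation′ (2 * n)) → G c → Semiregular c →
    (u w : Fin (2 * n)) → TwoOrbits c u w → InducesCycle Γ (InOrbit c u) →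
    (B : Subset (2 * n)) → IsBlock G B → NonTrivial B →
    (Σ (Fin (2 * n)) λ z → ∀ x → x ∈ B → InOrbit c z x) →
    2 * ∣ B ∣ < n →
    (∀ g → InKernel G B g ⇔ InSetwiseStab c B g) ×
    IsNormalCover Γ G B ×
    (Σ ℕ λ M → Σ (Graph M) λ Δ → Σ (Fin (2 * n) → Fin M) λ π →
    IsQuotient Γ G B Δ π × InF d Δ)
lemma4p1 d n 6≤d Γ Γ∈F G G≤AutΓ G-edge-transitive c c∈G c-semiregular u w c-orbits U-cycle
         B B-block B-nontrivial B-cyclic B-small =
  kernel≡setwise-stabiliser , normal-cover , M , Δ , π , is-quotient , Δ∈F
  where
  open Setting d n 6≤d Γ Γ∈F G G≤AutΓ G-edge-transitive c c∈G c-semiregular u w c-orbits U-cycle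
               B B-block B-nontrivial B-cyclic B-small
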